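{- For every named $\mathrm{GS4}$ derivation $P$ with conclusion $\vdash\Gamma$, the bl-graph $\langle\!\langle P\rangle\!\rangle$ is total with respect to $\vdash\Gamma$.
   Context: Named formulas and sequents. Fix a countably infinite set $\mathcal N$ of names and a set $\mathcal A$ of atoms with a fixpoint-free involution $\alpha\mapsto\bar\alpha$. Named formulas: $A,B::=\alpha^x\mid A\lor B\mid A\land B$ ($\alpha\in\mathcal A$, $x\in\mathcal N$); formulas $\alpha^x$ are atomic. Negation: $\overline{\alpha^x}=\bar\alpha^x$, $\overline{A\lor B}=\bar A\land\bar B$, $\overline{A\land B}=\bar A\lor\bar B$ (names preserved). $\mathrm{names}(A)$ is the set of names in $A$, $\mathrm{names}(\Gamma)=\bigcup_{A\in\Gamma}\mathrm{names}(A)$. $A\equiv B$ means $A,B$ coincide after erasing names. A formula is sharing-free if each name occurs in it at most once; a set is sharing-free if its members are sharing-free with pairwise disjoint name sets. A sequent $\vdash\Gamma$ is a finite sharing-free set $\Gamma$; in comma notation the components have pairwise disjoint name sets and $\Gamma,A=\Gamma\cup\{A\}$. For sharing-free $\Gamma$ and $x\in\mathrm{names}(\Gamma)$, $\Gamma[x]$ is the unique atom $\alpha$ with $\alpha^x$ a subformula of a member of $\Gamma$. Derivations. Named $\mathrm{GS4}$ derivations are finite trees of rule applications labelled with sharing-free sequents: axiom $\mathrm{ax}_{\{A,\bar B\}}$ (no premisses, conclusion $\vdash\Gamma,A,\bar B$, $A\equiv B$); cut (premisses $\vdash\Gamma,A$, $\vdash\Gamma,\bar A$, conclusion $\vdash\Gamma$);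 superposition $\sqcup$ (premisses $\vdash\Gamma$, $\vdash\Gamma$, conclusion $\vdash\Gamma$); $\lor$ (premiss $\vdash\Gamma,A,B$, conclusion $\vdash\Gamma,A\lor B$); $\land$ (premisses $\vdash\Gamma,A$, $\vdash\Gamma,B$, conclusion $\vdash\Gamma,A\land B$). Branches. $\mathrm{Br}(\alpha^x)=\{\{x\}\}$, $\mathrm{Br}(B\lor C)=\{X\cup Y\mid X\in\mathrm{Br}(B),Y\in\mathrm{Br}(C)\}$, $\mathrm{Br}(B\land C)=\mathrm{Br}(B)\cup\mathrm{Br}(C)$; for sharing-free $\Gamma$, $\mathrm{Br}(\Gamma)=\{X\subseteq\mathrm{names}(\Gamma)\mid\forall A\in\Gamma,\ X\cap\mathrm{names}(A)\in\mathrm{Br}(A)\}$. Branch-labeled graphs. A bl-graph is $G=\langle V_G,\triangleleft_G\rangle$ with $V_G\subseteq\mathcal N$ and $\triangleleft_G$ a relation between 2-element subsets $e$ of $V_G$ and subsets $X\subseteq V_G$ such that $e\triangleleft_G X$ implies $e\subseteq X$; edges $E_G=\{e\mid\exists X.\,e\triangleleft_G X\}$, branches $\mathrm{Br}(G)=\{X\mid\exists e.\,e\triangleleft_G X\}$. Union $\sqcup$ is componentwise union. For $I\subseteq\mathcal N$: $e\triangleleft^I_G X$ iff $e\triangleleft_G Y$ for some $Y$ with $X=Y\setminus I$. An alternating $X$-labeled path between bl-graphs $G,H$ through $I$ is a sequence $x_1,\dots,x_n$ ($n>1$) of pairwise distinct vertices of $G$ or $H$ with $x_i\in I$ for $1<i<n$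 such that either $x_ix_{i+1}\triangleleft^I_G X$ for all odd $i$ and $x_ix_{i+1}\triangleleft^I_H X$ for all even $i$, or the same with $G,H$ swapped; it is complete if $x_1,x_n\notin I$. $G\odot_I H$ has vertex set $V=(V_G\cup V_H)\setminus I$ and, for $x\ne y\in V$, $X\subseteq V$, $xy\triangleleft X$ iff there is a complete alternating $X$-labeled path from $x$ to $y$ between $G$ and $H$ through $I$; $\odot_A=\odot_{\mathrm{names}(A)}$. $\mathrm{wk}_\Gamma(G)=\langle V_G\cup\mathrm{names}(\Gamma),\{(e,X\cup Y)\mid e\triangleleft_G X,\,Y\in\mathrm{Br}(\Gamma)\}\rangle$. $\mathrm{id}_{\{\alpha^x,\bar\alpha^y\}}=\langle\{x,y\},\{(xy,\{x,y\})\}\rangle$, and for disjoint sharing-free $A_1\lor A_2$, $\bar B_1\land\bar B_2$ with $A_i\equiv B_i$, $\mathrm{id}_{\{A_1\lor A_2,\bar B_1\land\bar B_2\}}=\mathrm{wk}_{\{A_2\}}(\mathrm{id}_{\{A_1,\bar B_1\}})\sqcup\mathrm{wk}_{\{A_1\}}(\mathrm{id}_{\{A_2,\bar B_2\}})$ (every axiom pair of non-atomic formulas is an unordered pair of this shape). $\langle\!\langle P\rangle\!\rangle$ is $\mathrm{wk}_\Gamma(\mathrm{id}_{\{A,\bar B\}})$ for an axiom $\mathrm{ax}_{\{A,\bar B\}}$ with conclusion $\vdash\Gamma,A,\bar B$; $\langle\!\langle Q\rangle\!\rangle\odot_A\langle\!\langle R\rangle\!\rangle$ for a cut with premiss derivations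 $Q$ of $\vdash\Gamma,A$, $R$ of $\vdash\Gamma,\bar A$; the union of the premisses' bl-graphs for $\sqcup,\lor,\land$. Totality. A bl-graph $G$ is total w.r.t. a sharing-free sequent $\vdash\Gamma$ iff (i) $V_G=\mathrm{names}(\Gamma)$; (ii) $\mathrm{Br}(G)=\mathrm{Br}(\Gamma)$; (iii) for all $xy\in E_G$, $\Gamma[x]=\overline{\Gamma[y]}$. -}

module Defs where

import Level
open import Level using (0ℓ; Lift)
open import Data.Nat using (ℕ)
open import Data.List using (List; []; _∷_; _++_; concatMap; [_])
open import Data.List.Membership.Propositional using (_∈_; _∉_)
open import Data.List.Relation.Unary.All using (All)
open import Data.List.Relation.Unary.AllPairs using (AllPairs)
open import Data.List.Relation.Unary.Unique.Propositional using (Unique)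
open import Data.List.Relation.Binary.Permutation.Propositional using (_↭_)
open import Data.Product using (∃; ∃₂; _×_; _,_)
open import Data.Sum using (_⊎_)
open import Data.Unit.Polymorphic using (⊤)
open import Data.Empty.Polymorphic using (⊥)
open import Relation.Nullary using (¬_)
open import Relation.Binary.PropositionalEquality using (_≡_; _≢_)
open import Relation.Unary using (Pred; _⊆_; _≐_; _∪_; _∩_; _∖_; ｛_｝)
open import Function.Bundles using (_⇔_)

-- Names are natural numbers (a countably infinite set).
-- Sets of names (vertex sets, branch labels) are predicates on ℕ,
-- compared extensionally with _≐_.
Names : Set₁
Names = Pred ℕ 0ℓ

module GS4 (Atom : Set) (bar : Atom → Atom) where

  infixr 6 _∨_
  infixr 7 _∧_
  data Formula : Set where
    at  : Atom → ℕ → Formula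
    _∨_ : Formula → Formula → Formula
    _∧_ : Formula → Formula → Formula

  data Shape : Set where
    at  : Atom → Shape
    _∨_ : Shape → Shape → Shape
    _∧_ : Shape → Shape → Shape

  erase : Formula → Shape
  erase (at a x) = at a
  erase (A ∨ B) = erase A ∨ erase B
  erase (A ∧ B) = erase A ∧ erase B

  _≡ₑ_ : Formula → Formula → Set
  A ≡ₑ B = erase A ≡ erase B

  neg : Formula → Formula
  neg (at a x) = at (bar a) x
  neg (A ∨ B) = neg A ∧ neg B
  neg (A ∧ B) = neg A ∨ neg B

  names : Formula → List ℕ
  names (at a x) = x ∷ []
  names (A ∨ B) = names A ++ names B
  names (A ∧ B) = names A ++ names B

  namesP : Formula → Names
  namesP A x = x ∈ names A

  -- sequents are finite lists, read as sets (up to permutation)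
  namesS : List Formula → Names
  namesS Γ x = x ∈ concatMap names Γ

  data _⊑_ : Formula → Formula → Set where
    here : ∀ {A} → A ⊑ A
    ∨ˡ : ∀ {A B C} → A ⊑ B → A ⊑ (B ∨ C)
    ∨ʳ : ∀ {A B C} → A ⊑ C → A ⊑ (B ∨ C)
    ∧ˡ : ∀ {A B C} → A ⊑ B → A ⊑ (B ∧ C)
    ∧ʳ : ∀ {A B C} → A ⊑ C → A ⊑ (B ∧ C)

  SharingFreeF : Formula → Set
  SharingFreeF A = Unique (names A)

  DisjointNames : Formula → Formula → Set
  DisjointNames A B = ∀ {x} → x ∈ names A → x ∉ names B

  SharingFree : List Formula → Set
  SharingFree Γ = All SharingFreeF Γ × AllPairs DisjointNames Γ

  AtomAt : List Formula → ℕ → Atom → Set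
  AtomAt Γ x α = ∃ λ A → A ∈ Γ × at α x ⊑ A

  BrF : Formula → Names → Set₁
  BrF (at a x) X = Lift (Level.suc 0ℓ) (X ≐ ｛ x ｝)
  BrF (A ∨ B) X = ∃₂ λ Y Z → BrF A Y × BrF B Z × Lift (Level.suc 0ℓ) (X ≐ (Y ∪ Z))
  BrF (A ∧ B) X = BrF A X ⊎ BrF B X

  BrS : List Formula → Names → Set₁
  BrS Γ X = Lift (Level.suc 0ℓ) (X ⊆ namesS Γ) × (∀ A → A ∈ Γ → BrF A (X ∩ namesP A))

  -- Branch-labelled graphs.
  -- edge x y X  means  {x,y} ◁ X  (edges are unordered pairs; all
  -- constructions below are symmetric in x,y).
  record BLGraph : Set₂ where
    field
      V    : Names
      edge : ℕ → ℕ → Names → Set₁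
  open BLGraph public

  BrG : BLGraph → Names → Set₁
  BrG G X = ∃₂ λ x y → edge G x y X

  empty : BLGraph
  empty = record { V = λ _ → ⊥ ; edge = λ _ _ _ → ⊥ }

  _⊔_ : BLGraph → BLGraph → BLGraph
  G ⊔ H = record { V = V G ∪ V H ; edge = λ x y X → edge G x y X ⊎ edge H x y X }

  restrictEdge : BLGraph → Names → ℕ → ℕ → Names → Set₁
  restrictEdge G I x y X = ∃ λ Y → edge G x y Y × Lift (Level.suc 0ℓ) (X ≐ (Y ∖ I))

  AltFrom : BLGraph → BLGraph → Names → Names → List ℕ → Set₁
  AltFrom G H I X [] = ⊥
  AltFrom G H I X (x ∷ []) = ⊤
  AltFrom G H I X (x ∷ y ∷ p) = restrictEdge G I x y X × AltFrom H G I X (y ∷ p)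

  CompleteAltPath : BLGraph → BLGraph → Names → Names → ℕ → ℕ → Set₁
  CompleteAltPath G H I X x y = ∃ λ (ms : List ℕ) →
    let p = x ∷ (ms ++ [ y ]) in
      Lift (Level.suc 0ℓ) (Unique p × All (V G ∪ V H) p × All I ms)
    × Lift (Level.suc 0ℓ) (¬ I x × ¬ I y)
    × (AltFrom G H I X p ⊎ AltFrom H G I X p)

  _⊙[_]_ : BLGraph → Names → BLGraph → BLGraph
  G ⊙[ I ] H = record
    { V = W
    ; edge = λ x y X → Lift (Level.suc 0ℓ) (x ≢ y × W x × W y × X ⊆ W) × CompleteAltPath G H I X x y }
    where
    W : Names
    W = (V G ∪ V H) ∖ I

  wk : List Formula → BLGraph → BLGraph
  wk Γ G = record
    { V = V G ∪ namesS Γ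
    ; edge = λ x y X → ∃₂ λ X' Y → edge G x y X' × BrS Γ Y × Lift (Level.suc 0ℓ) (X ≐ (X' ∪ Y)) }

  -- id_{A, C} for an axiom pair {A, C}; the pair is unordered.
  -- (The last clauses are never used for genuine axiom pairs.)
  idG : Formula → Formula → BLGraph
  idG (at a x) (at b y) = record
    { V = ｛ x ｝ ∪ ｛ y ｝
    ; edge = λ u v X → ((u ≡ x × v ≡ y) ⊎ (u ≡ y × v ≡ x)) × Lift (Level.suc 0ℓ) (X ≐ (｛ x ｝ ∪ ｛ y ｝)) }
  idG (A₁ ∨ A₂) (C₁ ∧ C₂) = wk (A₂ ∷ []) (idG A₁ C₁) ⊔ wk (A₁ ∷ []) (idG A₂ C₂)
  idG (C₁ ∧ C₂) (A₁ ∨ A₂) = wk (A₂ ∷ []) (idG A₁ C₁) ⊔ wk (A₁ ∷ []) (idG A₂ C₂)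
  idG (at _ _) (_ ∨ _) = empty
  idG (at _ _) (_ ∧ _) = empty
  idG (_ ∨ _) (at _ _) = empty
  idG (_ ∨ _) (_ ∨ _) = empty
  idG (_ ∧ _) (at _ _) = empty
  idG (_ ∧ _) (_ ∧ _) = empty

  -- Sequents are sets: the conclusion of each rule is any list that is
  -- a permutation of the displayed one; every conclusion is sharing-free.
  -- "Γ , A" is A ∷ Γ (disjointness is enforced by sharing-freeness).
  data Deriv : List Formula → Set where
    ax  : ∀ {Δ} (Γ : List Formula) (A B : Formula) → A ≡ₑ B →
          Δ ↭ (A ∷ neg B ∷ Γ) → SharingFree Δ → Deriv Δ
    cut : ∀ {Δ} (Γ : List Formula) (A : Formula) →
          Deriv (A ∷ Γ) → Deriv (neg A ∷ Γ) →
          Δ ↭ Γ → SharingFree Δ → Deriv Δ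
    sup : ∀ {Δ} (Γ : List Formula) → Deriv Γ → Deriv Γ →
          Δ ↭ Γ → SharingFree Δ → Deriv Δ
    orR : ∀ {Δ} (Γ : List Formula) (A B : Formula) →
          Deriv (A ∷ B ∷ Γ) →
          Δ ↭ ((A ∨ B) ∷ Γ) → SharingFree Δ → Deriv Δ
    andR : ∀ {Δ} (Γ : List Formula) (A B : Formula) →
          Deriv (A ∷ Γ) → Deriv (B ∷ Γ) →
          Δ ↭ ((A ∧ B) ∷ Γ) → SharingFree Δ → Deriv Δ

  ⟪_⟫ : ∀ {Δ} → Deriv Δ → BLGraph
  ⟪ ax Γ A B _ _ _ ⟫ = wk Γ (idG A (neg B))
  ⟪ cut Γ A Q R _ _ ⟫ = ⟪ Q ⟫ ⊙[ namesP A ] ⟪ R ⟫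
  ⟪ sup Γ Q R _ _ ⟫ = ⟪ Q ⟫ ⊔ ⟪ R ⟫
  ⟪ orR Γ A B Q _ _ ⟫ = ⟪ Q ⟫
  ⟪ andR Γ A B Q R _ _ ⟫ = ⟪ Q ⟫ ⊔ ⟪ R ⟫

  Total : BLGraph → List Formula → Set₁
  Total G Γ =
      (∀ x → (V G x ⇔ namesS Γ x))
    × (∀ X → (BrG G X ⇔ BrS Γ X))
    × (∀ x y X → edge G x y X → ∀ α β → AtomAt Γ x α → AtomAt Γ y β → α ≡ bar β)

module Submission where

-- The invariant proved by induction on derivations is totality strengthened by two edge
-- properties: edges are symmetric and every edge lies in its own branch label. For a cut on A, a
-- branch of the conclusion extends, branch by branch of A and of neg A, to edges of the two
-- premiss graphs; by induction on A these edges chain into an alternating path between two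
-- vertices outside A, which can be made simple and is a complete path of the ⊙-composite.
-- Colouring each vertex by its atom in the premiss of the current side shows that a path
-- joins dual atoms, and rules out closed loops.

open import Defs
open import Level using (lift; lower)
open import Data.Nat using (ℕ; _≟_)
open import Data.List using (List; []; _∷_; _++_; [_]; concatMap; reverse)
open import Data.List.Properties using (++-assoc; ++-identityʳ; unfold-reverse; reverse-++)
open import Data.List.Membership.Propositional using (_∈_; _∉_)
open import Data.List.Membership.Propositional.Properties using (∈-++⁺ˡ; ∈-++⁺ʳ; ∈-++⁻)
open import Data.List.Relation.Unary.Any using (here; there; any?)
open import Data.List.Relation.Unary.All as All using (All; []; _∷_)
import Data.List.Relation.Unary.All.Properties as All
open import Data.List.Relation.Unary.AllPairs using ([]; _∷_)
open import Data.List.Relation.Unary.Unique.Propositional using (Unique)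
open import Data.List.Relation.Unary.Unique.Propositional.Properties using (Unique[x∷xs]⇒x∉xs) renaming (++⁺ to Unique-++⁺)
open import Data.List.Relation.Binary.Permutation.Propositional using (_↭_; ↭-sym; ↭-trans; ↭-prep; ↭-swap; ↭-refl; ↭⇒↭ₛ)
import Data.List.Relation.Binary.Permutation.Propositional as ↭
open import Data.List.Relation.Binary.Permutation.Propositional.Properties using (∈-resp-↭; ++⁺ˡ; shifts; ↭-reverse)
import Data.List.Relation.Binary.Permutation.Setoid.Properties as PermutationSetoid
open import Data.Product using (∃; ∃₂; _×_; _,_; proj₁; proj₂)
open import Data.Sum using (_⊎_; inj₁; inj₂; [_,_]′; map₁)
open import Data.Empty using (⊥; ⊥-elim)
open import Data.Unit.Polymorphic using (tt)
open import Relation.Nullary using (¬_; yes; no)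
open import Relation.Binary.PropositionalEquality using (_≡_; _≢_; refl; sym; trans; cong; cong₂; subst; setoid)
open import Relation.Unary using (_⊆_; _≐_; _∪_; _∩_; _∖_; ｛_｝)
open import Relation.Unary.Properties using (≐-refl; ≐-sym; ≐-trans)
open import Function.Bundles using (mk⇔)

module _ {A : Set} where

  Unique-∷ : ∀ {x : A} {xs} → x ∉ xs → Unique xs → Unique (x ∷ xs)
  Unique-∷ {xs = xs} x∉xs u = All.¬Any⇒All¬ xs x∉xs ∷ u

  Unique-++⁻ˡ : ∀ (xs : List A) {ys} → Unique (xs ++ ys) → Unique xs
  Unique-++⁻ˡ []       _       = []
  Unique-++⁻ˡ (x ∷ xs) (p ∷ u) = All.++⁻ˡ xs p ∷ Unique-++⁻ˡ xs u

  Unique-++⁻ʳ : ∀ (xs : List A) {ys} → Unique (xs ++ ys) → Unique ys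
  Unique-++⁻ʳ []       u       = u
  Unique-++⁻ʳ (x ∷ xs) (_ ∷ u) = Unique-++⁻ʳ xs u

  Unique-++⇒disjoint : ∀ (xs : List A) {ys z} → Unique (xs ++ ys) → z ∈ xs → z ∉ ys
  Unique-++⇒disjoint (x ∷ xs) u (here refl) z∈ys = Unique[x∷xs]⇒x∉xs u (∈-++⁺ʳ xs z∈ys)
  Unique-++⇒disjoint (x ∷ xs) (_ ∷ u) (there z∈xs) = Unique-++⇒disjoint xs u z∈xs

  Unique-drop-middle : ∀ (xs ys : List A) {zs} → Unique ((xs ++ ys) ++ zs) → Unique (xs ++ zs)
  Unique-drop-middle []       ys u       = Unique-++⁻ʳ ys u
  Unique-drop-middle (x ∷ xs) ys (p ∷ u) =
    All.++⁺ (All.++⁻ˡ xs (All.++⁻ˡ (xs ++ ys) p)) (All.++⁻ʳ (xs ++ ys) p) ∷ Unique-drop-middle xs ys u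

  ↭-swap₂ : ∀ (x y : A) → x ∷ y ∷ [] ↭ y ∷ x ∷ []
  ↭-swap₂ x y = ↭-swap x y ↭-refl

  Unique-resp-↭ : ∀ {xs ys : List A} → xs ↭ ys → Unique xs → Unique ys
  Unique-resp-↭ p = PermutationSetoid.Unique-resp-↭ (setoid A) (↭⇒↭ₛ p)

  reverse-∷-++-[] : ∀ (x : A) xs y → reverse (x ∷ xs ++ [ y ]) ≡ y ∷ reverse xs ++ [ x ]
  reverse-∷-++-[] x xs y = trans (unfold-reverse x (xs ++ [ y ])) (cong (_++ [ x ]) (reverse-++ xs [ y ]))

-- Alternating paths

data Side : Set where
  left right : Side

other : Side → Side
other left  = right
other right = left

other-involutive : ∀ s → other (other s) ≡ s
other-involutive left  = refl
other-involutive right = refl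

SidedRel : Set₂
SidedRel = Side → ℕ → ℕ → Set₁

data AltPath (R : SidedRel) (I : ℕ → Set) : Side → Side → ℕ → ℕ → List ℕ → Set₁ where
  last : ∀ {s x y} → R s x y → AltPath R I s s x y []
  step : ∀ {s t x m y ms} → R s x m → I m → AltPath R I (other s) t m y ms → AltPath R I s t x y (m ∷ ms)

AltPathBetween : SidedRel → (ℕ → Set) → Names → Set₁
AltPathBetween R I X = ∃₂ λ x y → X x × X y × ∃ λ s → ∃ λ t → ∃ λ ms → AltPath R I s t x y ms

module _ {R : SidedRel} {I : ℕ → Set} where

  AltPath-map : ∀ {R′ : SidedRel} {I′ : ℕ → Set} → (∀ {s x y} → R s x y → R′ s x y) → (∀ {x} → I x → I′ x) →
                ∀ {s t x y ms} → AltPath R I s t x y ms → AltPath R′ I′ s t x y ms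
  AltPath-map f g (last e)     = last (f e)
  AltPath-map f g (step e i p) = step (f e) (g i) (AltPath-map f g p)

  AltPath-++ : ∀ {s t t′ x m y ms ms′} → AltPath R I s t x m ms → I m → AltPath R I (other t) t′ m y ms′ →
               AltPath R I s t′ x y (ms ++ m ∷ ms′)
  AltPath-++ (last e)     i q = step e i q
  AltPath-++ (step e j p) i q = step e j (AltPath-++ p i q)

  AltPath-reverse : (∀ {s x y} → R s x y → R s y x) →
                    ∀ {s t x y ms} → AltPath R I s t x y ms → AltPath R I t s y x (reverse ms)
  AltPath-reverse sym-R (last e) = last (sym-R e)
  AltPath-reverse sym-R {s} {t} {x} {y} (step {m = m} {ms = ms} e i p) =
    subst (AltPath R I t s y x) (sym (unfold-reverse m ms))
      (AltPath-++ (AltPath-reverse sym-R p) i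
        (subst (λ s′ → AltPath R I s′ s m x []) (sym (other-involutive s)) (last (sym-R e))))

  AltPath-interior : ∀ {s t x y ms} → AltPath R I s t x y ms → All I ms
  AltPath-interior (last _)     = []
  AltPath-interior (step _ i p) = i ∷ AltPath-interior p

  AltPath-vertices : (Q : ℕ → Set) → (∀ {s x y} → R s x y → Q x × Q y) →
                     ∀ {s t x y ms} → AltPath R I s t x y ms → All Q (x ∷ ms ++ [ y ])
  AltPath-vertices Q f (last e)     = proj₁ (f e) ∷ proj₂ (f e) ∷ []
  AltPath-vertices Q f (step e _ p) = proj₁ (f e) ∷ AltPath-vertices Q f p

  AltPath-suffix : ∀ {s t m y ms z} → AltPath R I s t m y ms → z ∈ m ∷ ms →
                   ∃ λ s′ → ∃ λ ms₂ → ∃ λ pre → AltPath R I s′ t z y ms₂ × m ∷ ms ≡ pre ++ z ∷ ms₂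
  AltPath-suffix {s} {ms = ms} p (here refl) = s , ms , [] , p , refl
  AltPath-suffix {m = m} (step _ _ p) (there z∈ms) =
    let s′ , ms₂ , pre , q , eq = AltPath-suffix p z∈ms in s′ , ms₂ , m ∷ pre , q , cong (m ∷_) eq

AltPath-swap : ∀ {R I s t x y ms} → AltPath (λ s → R (other s)) I s t x y ms → AltPath R I (other s) (other t) x y ms
AltPath-swap {s = left}  (last e)     = last e
AltPath-swap {s = right} (last e)     = last e
AltPath-swap {s = left}  (step e i p) = step e i (AltPath-swap p)
AltPath-swap {s = right} (step e i p) = step e i (AltPath-swap p)

-- In a cut, the colour of a vertex on a side is its atom in that side's premiss.
module Colouring {C : Set} (bar : C → C) (bar-involutive : ∀ c → bar (bar c) ≡ c) (bar-fixpoint-free : ∀ c → bar c ≢ c)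
  (R : SidedRel) (I : ℕ → Set) (col : Side → ℕ → C → Set)
  (edge-colours : ∀ {s u v} → R s u v → ∃ λ c → col s u c × col s v (bar c))
  (col-functional : ∀ {s u c d} → col s u c → col s u d → c ≡ d)
  (col-inside : ∀ {s u c} → I u → col s u c → col (other s) u (bar c))
  (col-outside : ∀ {s u c} → ¬ I u → col s u c → col (other s) u c) where

  bar-injective : ∀ {c d} → bar c ≡ bar d → c ≡ d
  bar-injective {c} {d} eq = trans (sym (bar-involutive c)) (trans (cong bar eq) (bar-involutive d))

  col-not-bar : ∀ {s u c} → col s u c → col s u (bar c) → ⊥
  col-not-bar {c = c} p q = bar-fixpoint-free c (sym (col-functional p q))

  start-colour : ∀ {s t x y ms} → AltPath R I s t x y ms → ∃ λ c → col s x c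
  start-colour (last e)     = let c , cu , _ = edge-colours e in c , cu
  start-colour (step e _ _) = let c , cu , _ = edge-colours e in c , cu

  end-colour : ∀ {s t x y ms c} → AltPath R I s t x y ms → col s x c → col t y (bar c)
  end-colour (last e) cx =
    let _ , cu , cv = edge-colours e in subst (λ d → col _ _ (bar d)) (col-functional cu cx) cv
  end-colour {c = c} (step e i p) cx =
    let _ , cu , cv = edge-colours e
        cm = subst (λ d → col _ _ (bar d)) (col-functional cu cx) cv
    in end-colour p (subst (col _ _) (bar-involutive c) (col-inside i cm))

  no-loop : ∀ {s u ms} → AltPath R I s s u u ms → ⊥
  no-loop p = let _ , cu = start-colour p in col-not-bar cu (end-colour p cu)

  no-outside-loop : ∀ {s t u ms} → ¬ I u → AltPath R I s t u u ms → ⊥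
  no-outside-loop {left}  {left}  _  p = no-loop p
  no-outside-loop {right} {right} _  p = no-loop p
  no-outside-loop {left}  {right} ¬i p = let _ , cu = start-colour p in col-not-bar (col-outside ¬i cu) (end-colour p cu)
  no-outside-loop {right} {left}  ¬i p = let _ , cu = start-colour p in col-not-bar (col-outside ¬i cu) (end-colour p cu)

  opposite-start-sides : ∀ {s t x y ms ms′} → I x → AltPath R I s t x y ms → AltPath R I (other s) t x y ms′ → ⊥
  opposite-start-sides i p q =
    let c , cx = start-colour p
        d , dx = start-colour q
        c≡d = bar-injective (col-functional (end-colour p cx) (end-colour q dx))
    in col-not-bar (subst (col _ _) (sym c≡d) dx) (col-inside i cx)

  same-start-side : ∀ {s s′ t x y ms ms′} → I x → AltPath R I s t x y ms → AltPath R I s′ t x y ms′ → s ≡ s′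
  same-start-side {left}  {left}  _ _ _ = refl
  same-start-side {right} {right} _ _ _ = refl
  same-start-side {left}  {right} i p q = ⊥-elim (opposite-start-sides i p q)
  same-start-side {right} {left}  i p q = ⊥-elim (opposite-start-sides i p q)

  -- A repeated vertex lies in I, so both visits start on the same side by same-start-side
  -- and the loop between them can be cut out.
  simple-path : ∀ {s t x y ms} → ¬ I y → AltPath R I s t x y ms →
                ∃ λ t′ → ∃ λ ms′ → AltPath R I s t′ x y ms′ × Unique (x ∷ ms′ ++ [ y ])
  simple-path ¬iy (last e) = _ , [] , last e , Unique-∷ (λ { (here refl) → no-loop (last e) }) (Unique-∷ (λ ()) [])
  simple-path {s} {x = x} {y} ¬iy (step {m = m} e i p) with simple-path ¬iy p
  ... | t′ , ms′ , p′ , u′ with any? (x ≟_) (m ∷ ms′ ++ [ y ])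
  ...   | no x∉ = t′ , m ∷ ms′ , step e i p′ , Unique-∷ x∉ u′
  ...   | yes x∈ with ∈-++⁻ (m ∷ ms′) x∈
  ...     | inj₂ (here refl) = ⊥-elim (no-outside-loop ¬iy (step e i p′))
  ...     | inj₁ x∈m∷ms′ with AltPath-suffix p′ x∈m∷ms′
  ...       | s₂ , ms₂ , pre , r , eq =
    let ix = All.lookup (i ∷ AltPath-interior p′) x∈m∷ms′
    in t′ , ms₂ , subst (λ s′ → AltPath R I s′ t′ x y ms₂) (same-start-side ix r (step e i p′)) r
          , Unique-++⁻ʳ pre (subst Unique (++-assoc pre (x ∷ ms₂) [ y ]) (subst (λ l → Unique (l ++ [ y ])) eq u′))

module Syntax (Atom : Set) (bar : Atom → Atom) where
  open GS4 Atom bar public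

  nameList : List Formula → List ℕ
  nameList Γ = concatMap names Γ

  Distinct : List Formula → Set
  Distinct Γ = Unique (nameList Γ)

  names-neg : ∀ A → names (neg A) ≡ names A
  names-neg (at a x) = refl
  names-neg (A ∨ B)  = cong₂ _++_ (names-neg A) (names-neg B)
  names-neg (A ∧ B)  = cong₂ _++_ (names-neg A) (names-neg B)

  ∈names-neg⇒∈names : ∀ A {z} → z ∈ names (neg A) → z ∈ names A
  ∈names-neg⇒∈names A = subst (_ ∈_) (names-neg A)

  ∈names⇒∈names-neg : ∀ A {z} → z ∈ names A → z ∈ names (neg A)
  ∈names⇒∈names-neg A = subst (_ ∈_) (sym (names-neg A))

  ⊑-trans : ∀ {A B C} → A ⊑ B → B ⊑ C → A ⊑ C
  ⊑-trans p here   = p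
  ⊑-trans p (∨ˡ q) = ∨ˡ (⊑-trans p q)
  ⊑-trans p (∨ʳ q) = ∨ʳ (⊑-trans p q)
  ⊑-trans p (∧ˡ q) = ∧ˡ (⊑-trans p q)
  ⊑-trans p (∧ʳ q) = ∧ʳ (⊑-trans p q)

  ⊑-names : ∀ {A B} → A ⊑ B → ∀ {z} → z ∈ names A → z ∈ names B
  ⊑-names here          m = m
  ⊑-names (∨ˡ p)        m = ∈-++⁺ˡ (⊑-names p m)
  ⊑-names (∨ʳ {B = B} p) m = ∈-++⁺ʳ (names B) (⊑-names p m)
  ⊑-names (∧ˡ p)        m = ∈-++⁺ˡ (⊑-names p m)
  ⊑-names (∧ʳ {B = B} p) m = ∈-++⁺ʳ (names B) (⊑-names p m)

  at⊑⇒∈names : ∀ {a x A} → at a x ⊑ A → x ∈ names A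
  at⊑⇒∈names p = ⊑-names p (here refl)

  ⊑-neg : ∀ {a x A} → at a x ⊑ A → at (bar a) x ⊑ neg A
  ⊑-neg here   = here
  ⊑-neg (∨ˡ p) = ∧ˡ (⊑-neg p)
  ⊑-neg (∨ʳ p) = ∧ʳ (⊑-neg p)
  ⊑-neg (∧ˡ p) = ∨ˡ (⊑-neg p)
  ⊑-neg (∧ʳ p) = ∨ʳ (⊑-neg p)

  at⊑-functional : ∀ {a b x} A → Unique (names A) → at a x ⊑ A → at b x ⊑ A → a ≡ b
  at⊑-functional (at a x) u here here = refl
  at⊑-functional (A ∨ B) u (∨ˡ p) (∨ˡ q) = at⊑-functional A (Unique-++⁻ˡ (names A) u) p q
  at⊑-functional (A ∨ B) u (∨ʳ p) (∨ʳ q) = at⊑-functional B (Unique-++⁻ʳ (names A) u) p q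
  at⊑-functional (A ∨ B) u (∨ˡ p) (∨ʳ q) = ⊥-elim (Unique-++⇒disjoint (names A) u (at⊑⇒∈names p) (at⊑⇒∈names q))
  at⊑-functional (A ∨ B) u (∨ʳ p) (∨ˡ q) = ⊥-elim (Unique-++⇒disjoint (names A) u (at⊑⇒∈names q) (at⊑⇒∈names p))
  at⊑-functional (A ∧ B) u (∧ˡ p) (∧ˡ q) = at⊑-functional A (Unique-++⁻ˡ (names A) u) p q
  at⊑-functional (A ∧ B) u (∧ʳ p) (∧ʳ q) = at⊑-functional B (Unique-++⁻ʳ (names A) u) p q
  at⊑-functional (A ∧ B) u (∧ˡ p) (∧ʳ q) = ⊥-elim (Unique-++⇒disjoint (names A) u (at⊑⇒∈names p) (at⊑⇒∈names q))
  at⊑-functional (A ∧ B) u (∧ʳ p) (∧ˡ q) = ⊥-elim (Unique-++⇒disjoint (names A) u (at⊑⇒∈names q) (at⊑⇒∈names p))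

  ∈-nameList⁺ : ∀ {x A} Γ → A ∈ Γ → x ∈ names A → x ∈ nameList Γ
  ∈-nameList⁺ (C ∷ Γ) (here refl) m = ∈-++⁺ˡ m
  ∈-nameList⁺ (C ∷ Γ) (there p)   m = ∈-++⁺ʳ (names C) (∈-nameList⁺ Γ p m)

  ∈-nameList⁻ : ∀ {x} Γ → x ∈ nameList Γ → ∃ λ A → A ∈ Γ × x ∈ names A
  ∈-nameList⁻ (C ∷ Γ) m with ∈-++⁻ (names C) m
  ... | inj₁ p = C , here refl , p
  ... | inj₂ p = let A , q , r = ∈-nameList⁻ Γ p in A , there q , r

  nameList-++ : ∀ Σ Γ → nameList (Σ ++ Γ) ≡ nameList Σ ++ nameList Γ
  nameList-++ []      Γ = refl
  nameList-++ (C ∷ Σ) Γ = trans (cong (names C ++_) (nameList-++ Σ Γ)) (sym (++-assoc (names C) (nameList Σ) (nameList Γ)))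

  nameList-↭ : ∀ {Γ Δ} → Γ ↭ Δ → nameList Γ ↭ nameList Δ
  nameList-↭ ↭.refl         = ↭-refl
  nameList-↭ (↭.prep A p)   = ++⁺ˡ (names A) (nameList-↭ p)
  nameList-↭ (↭.swap A B p) = ↭-trans (shifts (names A) (names B)) (++⁺ˡ (names B) (++⁺ˡ (names A) (nameList-↭ p)))
  nameList-↭ (↭.trans p q)  = ↭-trans (nameList-↭ p) (nameList-↭ q)

  ∈-nameList-↭ : ∀ {Γ Δ x} → Γ ↭ Δ → x ∈ nameList Γ → x ∈ nameList Δ
  ∈-nameList-↭ p = ∈-resp-↭ (nameList-↭ p)

  sharingFree⇒distinct : ∀ {Γ} → SharingFree Γ → Distinct Γ
  sharingFree⇒distinct {[]}    _                 = []
  sharingFree⇒distinct {C ∷ Γ} (u ∷ us , d ∷ ds) =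
    Unique-++⁺ u (sharingFree⇒distinct (us , ds))
        (λ (p , q) → let A , r , s = ∈-nameList⁻ Γ q in All.lookup d r p s)

  conclusion-distinct : ∀ {Δ} → Deriv Δ → Distinct Δ
  conclusion-distinct (ax _ _ _ _ _ sf)     = sharingFree⇒distinct sf
  conclusion-distinct (cut _ _ _ _ _ sf)    = sharingFree⇒distinct sf
  conclusion-distinct (sup _ _ _ _ sf)      = sharingFree⇒distinct sf
  conclusion-distinct (orR _ _ _ _ _ sf)    = sharingFree⇒distinct sf
  conclusion-distinct (andR _ _ _ _ _ _ sf) = sharingFree⇒distinct sf

  Distinct-↭ : ∀ {Γ Δ} → Γ ↭ Δ → Distinct Γ → Distinct Δ
  Distinct-↭ p = Unique-resp-↭ (nameList-↭ p)

  Distinct-++⁻ˡ : ∀ Σ Γ → Distinct (Σ ++ Γ) → Distinct Σ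
  Distinct-++⁻ˡ Σ Γ u = Unique-++⁻ˡ (nameList Σ) (subst Unique (nameList-++ Σ Γ) u)

  Distinct-++⇒disjoint : ∀ Σ Γ {z} → Distinct (Σ ++ Γ) → z ∈ nameList Σ → z ∉ nameList Γ
  Distinct-++⇒disjoint Σ Γ u = Unique-++⇒disjoint (nameList Σ) (subst Unique (nameList-++ Σ Γ) u)

  Distinct-∨⁻ : ∀ A B Γ → Distinct ((A ∨ B) ∷ Γ) → Distinct (A ∷ B ∷ Γ)
  Distinct-∨⁻ A B Γ = subst Unique (++-assoc (names A) (names B) (nameList Γ))

  Distinct-∧⁻ˡ : ∀ A B Γ → Distinct ((A ∧ B) ∷ Γ) → Distinct (A ∷ Γ)
  Distinct-∧⁻ˡ A B Γ = Unique-drop-middle (names A) (names B)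

  Distinct-∧⁻ʳ : ∀ A B Γ → Distinct ((A ∧ B) ∷ Γ) → Distinct (B ∷ Γ)
  Distinct-∧⁻ʳ A B Γ u = Unique-++⁻ʳ (names A) (subst Unique (++-assoc (names A) (names B) (nameList Γ)) u)

  Distinct-∨⁻ˡ : ∀ A B Γ → Distinct ((A ∨ B) ∷ Γ) → Distinct (A ∷ Γ)
  Distinct-∨⁻ˡ = Distinct-∧⁻ˡ

  Distinct-∨⁻ʳ : ∀ A B Γ → Distinct ((A ∨ B) ∷ Γ) → Distinct (B ∷ Γ)
  Distinct-∨⁻ʳ = Distinct-∧⁻ʳ

  AtomAt⇒∈nameList : ∀ {Γ x a} → AtomAt Γ x a → x ∈ nameList Γ
  AtomAt⇒∈nameList {Γ} (A , m , p) = ∈-nameList⁺ Γ m (at⊑⇒∈names p)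

  AtomAt-functional : ∀ {Γ x a b} → Distinct Γ → AtomAt Γ x a → AtomAt Γ x b → a ≡ b
  AtomAt-functional {C ∷ Γ} u (_ , here refl , p) (_ , here refl , q) = at⊑-functional C (Unique-++⁻ˡ (names C) u) p q
  AtomAt-functional {C ∷ Γ} u (_ , here refl , p) (B , there r , q) =
    ⊥-elim (Unique-++⇒disjoint (names C) u (at⊑⇒∈names p) (AtomAt⇒∈nameList (B , r , q)))
  AtomAt-functional {C ∷ Γ} u (A , there r , p) (_ , here refl , q) =
    ⊥-elim (Unique-++⇒disjoint (names C) u (at⊑⇒∈names q) (AtomAt⇒∈nameList (A , r , p)))
  AtomAt-functional {C ∷ Γ} u (A , there r , p) (B , there s , q) =
    AtomAt-functional {Γ} (Unique-++⁻ʳ (names C) u) (A , r , p) (B , s , q)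

  BrF⇒⊆names : ∀ A {B} → BrF A B → B ⊆ namesP A
  BrF⇒⊆names (at a x) (lift (B⊆x , _)) m = subst (_∈ [ x ]) (B⊆x m) (here refl)
  BrF⇒⊆names (A ∨ B) (_ , _ , p , q , lift (⊆Y∪Z , _)) m with ⊆Y∪Z m
  ... | inj₁ y = ∈-++⁺ˡ (BrF⇒⊆names A p y)
  ... | inj₂ z = ∈-++⁺ʳ (names A) (BrF⇒⊆names B q z)
  BrF⇒⊆names (A ∧ B) (inj₁ p) m = ∈-++⁺ˡ (BrF⇒⊆names A p m)
  BrF⇒⊆names (A ∧ B) (inj₂ q) m = ∈-++⁺ʳ (names A) (BrF⇒⊆names B q m)

  BrF-resp-≐ : ∀ A {X Y} → X ≐ Y → BrF A X → BrF A Y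
  BrF-resp-≐ (at a x) e (lift e′)                 = lift (≐-trans (≐-sym e) e′)
  BrF-resp-≐ (A ∨ B)  e (Y , Z , p , q , lift e′) = Y , Z , p , q , lift (≐-trans (≐-sym e) e′)
  BrF-resp-≐ (A ∧ B)  e (inj₁ p)                  = inj₁ (BrF-resp-≐ A e p)
  BrF-resp-≐ (A ∧ B)  e (inj₂ p)                  = inj₂ (BrF-resp-≐ B e p)

  ∩-resp-≐ : ∀ {X Y : Names} (Z : Names) → X ≐ Y → (X ∩ Z) ≐ (Y ∩ Z)
  ∩-resp-≐ Z (X⊆Y , Y⊆X) = (λ (p , q) → X⊆Y p , q) , (λ (p , q) → Y⊆X p , q)

  BrS-resp-≐ : ∀ Γ {X Y} → X ≐ Y → BrS Γ X → BrS Γ Y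
  BrS-resp-≐ Γ e (lift X⊆ , f) = lift (λ m → X⊆ (proj₂ e m)) , λ A m → BrF-resp-≐ A (∩-resp-≐ (namesP A) e) (f A m)

  BrS-↭ : ∀ {Γ Δ X} → Γ ↭ Δ → BrS Γ X → BrS Δ X
  BrS-↭ p (lift X⊆ , f) = lift (λ m → ∈-nameList-↭ p (X⊆ m)) , λ A m → f A (∈-resp-↭ (↭-sym p) m)

  BrS-++⁺ : ∀ Σ Γ {X Y} → Distinct (Σ ++ Γ) → BrS Σ X → BrS Γ Y → BrS (Σ ++ Γ) (X ∪ Y)
  BrS-++⁺ Σ Γ {X} {Y} u (lift X⊆ , fX) (lift Y⊆ , fY) = lift X∪Y⊆ , f
    where
    X∪Y⊆ : (X ∪ Y) ⊆ namesS (Σ ++ Γ)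
    X∪Y⊆ (inj₁ p) = subst (_ ∈_) (sym (nameList-++ Σ Γ)) (∈-++⁺ˡ (X⊆ p))
    X∪Y⊆ (inj₂ p) = subst (_ ∈_) (sym (nameList-++ Σ Γ)) (∈-++⁺ʳ (nameList Σ) (Y⊆ p))
    f : ∀ A → A ∈ Σ ++ Γ → BrF A ((X ∪ Y) ∩ namesP A)
    f A m with ∈-++⁻ Σ m
    ... | inj₁ p = BrF-resp-≐ A ((λ (q , r) → inj₁ q , r) , onlyX) (fX A p)
      where
      onlyX : (X ∪ Y) ∩ namesP A ⊆ X ∩ namesP A
      onlyX (inj₁ q , r) = q , r
      onlyX (inj₂ q , r) = ⊥-elim (Distinct-++⇒disjoint Σ Γ u (∈-nameList⁺ Σ p r) (Y⊆ q))
    ... | inj₂ p = BrF-resp-≐ A ((λ (q , r) → inj₂ q , r) , onlyY) (fY A p)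
      where
      onlyY : (X ∪ Y) ∩ namesP A ⊆ Y ∩ namesP A
      onlyY (inj₂ q , r) = q , r
      onlyY (inj₁ q , r) = ⊥-elim (Distinct-++⇒disjoint Σ Γ u (X⊆ q) (∈-nameList⁺ Γ p r))

  BrS-restrict : ∀ Σ Γ {Z} → (∀ {A} → A ∈ Σ → A ∈ Γ) → BrS Γ Z → BrS Σ (Z ∩ namesS Σ)
  BrS-restrict Σ Γ Σ⊆Γ (_ , f) =
    lift proj₂ , λ A m → BrF-resp-≐ A ((λ (p , q) → (p , ∈-nameList⁺ Σ m q) , q) , (λ ((p , _) , q) → p , q)) (f A (Σ⊆Γ m))

  BrS-++⁻ : ∀ Σ Γ {Z} → BrS (Σ ++ Γ) Z →
            BrS Σ (Z ∩ namesS Σ) × BrS Γ (Z ∩ namesS Γ) × Z ≐ ((Z ∩ namesS Σ) ∪ (Z ∩ namesS Γ))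
  BrS-++⁻ Σ Γ {Z} b@(lift Z⊆ , _) = BrS-restrict Σ (Σ ++ Γ) ∈-++⁺ˡ b , BrS-restrict Γ (Σ ++ Γ) (∈-++⁺ʳ Σ) b , split
    where
    split : Z ≐ ((Z ∩ namesS Σ) ∪ (Z ∩ namesS Γ))
    proj₁ split p with ∈-++⁻ (nameList Σ) (subst (_ ∈_) (nameList-++ Σ Γ) (Z⊆ p))
    ... | inj₁ q = inj₁ (p , q)
    ... | inj₂ q = inj₂ (p , q)
    proj₂ split (inj₁ (p , _)) = p
    proj₂ split (inj₂ (p , _)) = p

  BrS-[_]⁺ : ∀ A {X} → BrF A X → BrS [ A ] X
  BrS-[ A ]⁺ b = lift (λ m → ∈-++⁺ˡ (BrF⇒⊆names A b m)) ,
                 λ { C (here refl) → BrF-resp-≐ C ((λ p → p , BrF⇒⊆names C b p) , proj₁) b }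

  BrS-[_]⁻ : ∀ A {X} → BrS [ A ] X → BrF A X
  BrS-[ A ]⁻ (lift X⊆ , f) =
    BrF-resp-≐ A (proj₁ , λ p → p , subst (_ ∈_) (++-identityʳ (names A)) (X⊆ p)) (f A (here refl))

  BrS-replace : ∀ Σ Σ′ Γ {X} → Distinct (Σ′ ++ Γ) → (∀ {Y} → BrS Σ Y → BrS Σ′ Y) → BrS (Σ ++ Γ) X → BrS (Σ′ ++ Γ) X
  BrS-replace Σ Σ′ Γ u′ h b =
    let bΣ , bΓ , e = BrS-++⁻ Σ Γ b in BrS-resp-≐ (Σ′ ++ Γ) (≐-sym e) (BrS-++⁺ Σ′ Γ u′ (h bΣ) bΓ)

  BrS-∷⁺ : ∀ A Γ {B X} → Distinct (A ∷ Γ) → BrF A B → BrS Γ X → BrS (A ∷ Γ) (B ∪ X)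
  BrS-∷⁺ A Γ u b = BrS-++⁺ [ A ] Γ u (BrS-[ A ]⁺ b)

  BrS-∷⁻ : ∀ A Γ {Y} → Distinct (A ∷ Γ) → BrS (A ∷ Γ) Y → BrS Γ (Y ∖ namesP A)
  BrS-∷⁻ A Γ {Y} u b@(lift Y⊆ , _) =
    let _ , bΓ , _ = BrS-++⁻ [ A ] Γ b
    in BrS-resp-≐ Γ ((λ (p , q) → p , λ r → Distinct-++⇒disjoint [ A ] Γ u (∈-++⁺ˡ r) q) , (λ (p , q) → p , inΓ (Y⊆ p) q)) bΓ
    where
    inΓ : ∀ {z} → z ∈ nameList (A ∷ Γ) → z ∉ names A → z ∈ nameList Γ
    inΓ m z∉A with ∈-++⁻ (names A) m
    ... | inj₁ p = ⊥-elim (z∉A p)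
    ... | inj₂ p = p

  BrS-∨⁺ : ∀ A B {X} → BrS (A ∷ B ∷ []) X → BrS [ A ∨ B ] X
  BrS-∨⁺ A B b = let bA , bB , e = BrS-++⁻ [ A ] [ B ] b in BrS-[ A ∨ B ]⁺ (_ , _ , BrS-[ A ]⁻ bA , BrS-[ B ]⁻ bB , lift e)

  BrS-∨⁻ : ∀ A B {X} → Distinct (A ∷ B ∷ []) → BrS [ A ∨ B ] X → BrS (A ∷ B ∷ []) X
  BrS-∨⁻ A B u b with BrS-[ A ∨ B ]⁻ b
  ... | _ , _ , p , q , lift e = BrS-resp-≐ (A ∷ B ∷ []) (≐-sym e) (BrS-++⁺ [ A ] [ B ] u (BrS-[ A ]⁺ p) (BrS-[ B ]⁺ q))

  BrS-∧⁺ˡ : ∀ A B Γ {X} → Distinct ((A ∧ B) ∷ Γ) → BrS (A ∷ Γ) X → BrS ((A ∧ B) ∷ Γ) X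
  BrS-∧⁺ˡ A B Γ u = BrS-replace [ A ] [ A ∧ B ] Γ u (λ b → BrS-[ A ∧ B ]⁺ (inj₁ (BrS-[ A ]⁻ b)))

  BrS-∧⁺ʳ : ∀ A B Γ {X} → Distinct ((A ∧ B) ∷ Γ) → BrS (B ∷ Γ) X → BrS ((A ∧ B) ∷ Γ) X
  BrS-∧⁺ʳ A B Γ u = BrS-replace [ B ] [ A ∧ B ] Γ u (λ b → BrS-[ A ∧ B ]⁺ (inj₂ (BrS-[ B ]⁻ b)))

  BrS-∧⁻ : ∀ A B Γ {X} → Distinct ((A ∧ B) ∷ Γ) → BrS ((A ∧ B) ∷ Γ) X → BrS (A ∷ Γ) X ⊎ BrS (B ∷ Γ) X
  BrS-∧⁻ A B Γ u b with BrS-++⁻ [ A ∧ B ] Γ b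
  ... | bA∧B , bΓ , e with BrS-[ A ∧ B ]⁻ bA∧B
  ...   | inj₁ bA = inj₁ (BrS-resp-≐ (A ∷ Γ) (≐-sym e) (BrS-∷⁺ A Γ (Distinct-∧⁻ˡ A B Γ u) bA bΓ))
  ...   | inj₂ bB = inj₂ (BrS-resp-≐ (B ∷ Γ) (≐-sym e) (BrS-∷⁺ B Γ (Distinct-∧⁻ʳ A B Γ u) bB bΓ))

  -- The strengthened totality invariant

  _⊑*_ : List Formula → List Formula → Set
  Γ ⊑* Δ = ∀ {A} → A ∈ Γ → ∃ λ B → B ∈ Δ × A ⊑ B

  ↭⇒⊑* : ∀ {Γ Δ} → Γ ↭ Δ → Γ ⊑* Δ
  ↭⇒⊑* p {A} m = A , ∈-resp-↭ p m , here

  ++⇒⊑* : ∀ Σ Γ → Σ ⊑* (Σ ++ Γ)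
  ++⇒⊑* Σ Γ {A} m = A , ∈-++⁺ˡ m , here

  AtomAt-mono : ∀ {Γ Δ x a} → Γ ⊑* Δ → AtomAt Γ x a → AtomAt Δ x a
  AtomAt-mono Γ⊑Δ (A , m , p) = let B , m′ , q = Γ⊑Δ m in B , m′ , ⊑-trans p q

  ∈-nameList-mono : ∀ {Γ Δ} → Γ ⊑* Δ → ∀ {z} → z ∈ nameList Γ → z ∈ nameList Δ
  ∈-nameList-mono {Γ} {Δ} Γ⊑Δ m =
    let A , r , s = ∈-nameList⁻ Γ m ; B , r′ , q = Γ⊑Δ r in ∈-nameList⁺ Δ r′ (⊑-names q s)

  DualEdges : BLGraph → List Formula → Set₁
  DualEdges G Γ = ∀ {x y X} → edge G x y X → ∃ λ a → AtomAt Γ x a × AtomAt Γ y (bar a)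

  DualEdges-mono : ∀ {G Γ Δ} → Γ ⊑* Δ → DualEdges G Γ → DualEdges G Δ
  DualEdges-mono Γ⊑Δ dual e = let a , p , q = dual e in a , AtomAt-mono Γ⊑Δ p , AtomAt-mono Γ⊑Δ q

  record Total⁺ (G : BLGraph) (Γ : List Formula) : Set₂ where
    field
      V⊆names    : ∀ {x} → V G x → x ∈ nameList Γ
      names⊆V    : ∀ {x} → x ∈ nameList Γ → V G x
      BrG⊆BrS    : ∀ {X} → BrG G X → BrS Γ X
      BrS⊆BrG    : ∀ {X} → BrS Γ X → BrG G X
      edge-sym   : ∀ {x y X} → edge G x y X → edge G y x X
      edge-label : ∀ {x y X} → edge G x y X → X x × X y
      edge-dual  : DualEdges G Γ
  open Total⁺ public

  Total⁺-↭ : ∀ {G Γ Δ} → Γ ↭ Δ → Total⁺ G Γ → Total⁺ G Δ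
  Total⁺-↭ {G} p T = record
    { V⊆names    = λ v → ∈-nameList-↭ p (V⊆names T v)
    ; names⊆V    = λ m → names⊆V T (∈-nameList-↭ (↭-sym p) m)
    ; BrG⊆BrS    = λ b → BrS-↭ p (BrG⊆BrS T b)
    ; BrS⊆BrG    = λ b → BrS⊆BrG T (BrS-↭ (↭-sym p) b)
    ; edge-sym   = edge-sym T
    ; edge-label = edge-label T
    ; edge-dual  = DualEdges-mono {G} (↭⇒⊑* p) (edge-dual T) }

  Total⁺-⊔ : ∀ {G H Γ} → Total⁺ G Γ → Total⁺ H Γ → Total⁺ (G ⊔ H) Γ
  Total⁺-⊔ T U = record
    { V⊆names    = λ { (inj₁ v) → V⊆names T v ; (inj₂ v) → V⊆names U v }
    ; names⊆V    = λ m → inj₁ (names⊆V T m)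
    ; BrG⊆BrS    = λ { (x , y , inj₁ e) → BrG⊆BrS T (x , y , e) ; (x , y , inj₂ e) → BrG⊆BrS U (x , y , e) }
    ; BrS⊆BrG    = λ b → let x , y , e = BrS⊆BrG T b in x , y , inj₁ e
    ; edge-sym   = λ { (inj₁ e) → inj₁ (edge-sym T e) ; (inj₂ e) → inj₂ (edge-sym U e) }
    ; edge-label = λ { (inj₁ e) → edge-label T e ; (inj₂ e) → edge-label U e }
    ; edge-dual  = λ { (inj₁ e) → edge-dual T e ; (inj₂ e) → edge-dual U e } }

  Total⁺-∨ : ∀ {G} A B Γ → Distinct ((A ∨ B) ∷ Γ) → Total⁺ G (A ∷ B ∷ Γ) → Total⁺ G ((A ∨ B) ∷ Γ)
  Total⁺-∨ {G} A B Γ u T = record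
    { V⊆names    = λ v → subst (_ ∈_) (sym assoc) (V⊆names T v)
    ; names⊆V    = λ m → names⊆V T (subst (_ ∈_) assoc m)
    ; BrG⊆BrS    = λ b → BrS-replace (A ∷ B ∷ []) [ A ∨ B ] Γ u (BrS-∨⁺ A B) (BrG⊆BrS T b)
    ; BrS⊆BrG    = λ b → BrS⊆BrG T (BrS-replace [ A ∨ B ] (A ∷ B ∷ []) Γ u′ (BrS-∨⁻ A B (Distinct-++⁻ˡ (A ∷ B ∷ []) Γ u′)) b)
    ; edge-sym   = edge-sym T
    ; edge-label = edge-label T
    ; edge-dual  = DualEdges-mono {G} premiss⊑ (edge-dual T) }
    where
    assoc = ++-assoc (names A) (names B) (nameList Γ)
    u′ = Distinct-∨⁻ A B Γ u
    premiss⊑ : (A ∷ B ∷ Γ) ⊑* ((A ∨ B) ∷ Γ)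
    premiss⊑ (here refl)         = _ , here refl , ∨ˡ here
    premiss⊑ (there (here refl)) = _ , here refl , ∨ʳ here
    premiss⊑ (there (there m))   = _ , there m , here

  Total⁺-∧ : ∀ {G H} A B Γ → Distinct ((A ∧ B) ∷ Γ) → Total⁺ G (A ∷ Γ) → Total⁺ H (B ∷ Γ) → Total⁺ (G ⊔ H) ((A ∧ B) ∷ Γ)
  Total⁺-∧ {G} {H} A B Γ u T U = record
    { V⊆names    = λ { (inj₁ v) → ∈-nameList-mono A⊑ (V⊆names T v) ; (inj₂ v) → ∈-nameList-mono B⊑ (V⊆names U v) }
    ; names⊆V    = names⊆V′
    ; BrG⊆BrS    = λ { (x , y , inj₁ e) → BrS-∧⁺ˡ A B Γ u (BrG⊆BrS T (x , y , e))
                     ; (x , y , inj₂ e) → BrS-∧⁺ʳ A B Γ u (BrG⊆BrS U (x , y , e)) }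
    ; BrS⊆BrG    = λ b → [ (λ bA → let x , y , e = BrS⊆BrG T bA in x , y , inj₁ e)
                         , (λ bB → let x , y , e = BrS⊆BrG U bB in x , y , inj₂ e) ]′ (BrS-∧⁻ A B Γ u b)
    ; edge-sym   = λ { (inj₁ e) → inj₁ (edge-sym T e) ; (inj₂ e) → inj₂ (edge-sym U e) }
    ; edge-label = λ { (inj₁ e) → edge-label T e ; (inj₂ e) → edge-label U e }
    ; edge-dual  = λ { (inj₁ e) → DualEdges-mono {G} A⊑ (edge-dual T) e ; (inj₂ e) → DualEdges-mono {H} B⊑ (edge-dual U) e } }
    where
    A⊑ : (A ∷ Γ) ⊑* ((A ∧ B) ∷ Γ)
    A⊑ (here refl) = _ , here refl , ∧ˡ here
    A⊑ (there m)   = _ , there m , here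
    B⊑ : (B ∷ Γ) ⊑* ((A ∧ B) ∷ Γ)
    B⊑ (here refl) = _ , here refl , ∧ʳ here
    B⊑ (there m)   = _ , there m , here
    names⊆V′ : ∀ {x} → x ∈ nameList ((A ∧ B) ∷ Γ) → V (G ⊔ H) x
    names⊆V′ m with ∈-++⁻ (names A ++ names B) m
    ... | inj₂ p = inj₁ (names⊆V T (∈-++⁺ʳ (names A) p))
    ... | inj₁ p with ∈-++⁻ (names A) p
    ...   | inj₁ q = inj₁ (names⊆V T (∈-++⁺ˡ q))
    ...   | inj₂ q = inj₂ (names⊆V U (∈-++⁺ˡ q))

  Total⁺-wk : ∀ {G} Σ Γ → Distinct (Σ ++ Γ) → Total⁺ G Σ → Total⁺ (wk Γ G) (Σ ++ Γ)
  Total⁺-wk {G} Σ Γ u T = record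
    { V⊆names    = λ { (inj₁ v) → ∈-nameList-mono (++⇒⊑* Σ Γ) (V⊆names T v)
                     ; (inj₂ v) → subst (_ ∈_) (sym (nameList-++ Σ Γ)) (∈-++⁺ʳ (nameList Σ) v) }
    ; names⊆V    = λ m → map₁ (names⊆V T) (∈-++⁻ (nameList Σ) (subst (_ ∈_) (nameList-++ Σ Γ) m))
    ; BrG⊆BrS    = λ { (x , y , _ , _ , e , b , lift eq) → BrS-resp-≐ (Σ ++ Γ) (≐-sym eq) (BrS-++⁺ Σ Γ u (BrG⊆BrS T (x , y , e)) b) }
    ; BrS⊆BrG    = λ b → let bΣ , bΓ , eq = BrS-++⁻ Σ Γ b ; x , y , e = BrS⊆BrG T bΣ in x , y , _ , _ , e , bΓ , lift eq
    ; edge-sym   = λ { (X′ , Y , e , b , eq) → X′ , Y , edge-sym T e , b , eq }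
    ; edge-label = λ { (_ , _ , e , _ , lift eq) → let p , q = edge-label T e in proj₂ eq (inj₁ p) , proj₂ eq (inj₁ q) }
    ; edge-dual  = λ { (_ , _ , e , _) → DualEdges-mono {G} (++⇒⊑* Σ Γ) (edge-dual T) e } }

module Totality (Atom : Set) (bar : Atom → Atom) (bar-involutive : ∀ a → bar (bar a) ≡ a) (bar-fixpoint-free : ∀ a → bar a ≢ a) where
  open Syntax Atom bar

  neg-involutive : ∀ A → neg (neg A) ≡ A
  neg-involutive (at a x) = cong (λ b → at b x) (bar-involutive a)
  neg-involutive (A ∨ B)  = cong₂ _∨_ (neg-involutive A) (neg-involutive B)
  neg-involutive (A ∧ B)  = cong₂ _∧_ (neg-involutive A) (neg-involutive B)

  dualShape : Shape → Shape
  dualShape (at a)  = at (bar a)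
  dualShape (s ∨ t) = dualShape s ∧ dualShape t
  dualShape (s ∧ t) = dualShape s ∨ dualShape t

  erase-neg : ∀ A → erase (neg A) ≡ dualShape (erase A)
  erase-neg (at a x) = refl
  erase-neg (A ∨ B)  = cong₂ _∧_ (erase-neg A) (erase-neg B)
  erase-neg (A ∧ B)  = cong₂ _∨_ (erase-neg A) (erase-neg B)

  ≡ₑ-neg : ∀ {A B} → A ≡ₑ B → neg A ≡ₑ neg B
  ≡ₑ-neg {A} {B} eq = trans (erase-neg A) (trans (cong dualShape eq) (sym (erase-neg B)))

  ∨-injective : ∀ {s₁ s₂ t₁ t₂ : Shape} → s₁ ∨ s₂ ≡ t₁ ∨ t₂ → s₁ ≡ t₁ × s₂ ≡ t₂
  ∨-injective refl = refl , refl

  ∧-injective : ∀ {s₁ s₂ t₁ t₂ : Shape} → s₁ ∧ s₂ ≡ t₁ ∧ t₂ → s₁ ≡ t₁ × s₂ ≡ t₂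
  ∧-injective refl = refl , refl

  Total⁺-idG-at : ∀ a x y → Total⁺ (idG (at a x) (at (bar a) y)) (at a x ∷ at (bar a) y ∷ [])
  Total⁺-idG-at a x y = record
    { V⊆names    = λ { (inj₁ refl) → here refl ; (inj₂ refl) → there (here refl) }
    ; names⊆V    = λ { (here refl) → inj₁ refl ; (there (here refl)) → inj₂ refl }
    ; BrG⊆BrS    = λ { (_ , _ , _ , lift e) → BrS-resp-≐ L (≐-sym e) BrS-xy }
    ; BrS⊆BrG    = λ b → x , y , inj₁ (refl , refl) , lift (BrS⇒≐xy b)
    ; edge-sym   = λ { (inj₁ (p , q) , e) → inj₂ (q , p) , e ; (inj₂ (p , q) , e) → inj₁ (q , p) , e }
    ; edge-label = λ { (inj₁ (refl , refl) , lift e) → proj₂ e (inj₁ refl) , proj₂ e (inj₂ refl)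
                     ; (inj₂ (refl , refl) , lift e) → proj₂ e (inj₂ refl) , proj₂ e (inj₁ refl) }
    ; edge-dual  = λ { (inj₁ (refl , refl) , _) → a , (_ , here refl , here) , (_ , there (here refl) , here)
                     ; (inj₂ (refl , refl) , _) → bar a , (_ , there (here refl) , here)
                                                 , (_ , here refl , subst (λ c → at c x ⊑ at a x) (sym (bar-involutive a)) here) } }
    where
    L = at a x ∷ at (bar a) y ∷ []
    BrS-xy : BrS L (｛ x ｝ ∪ ｛ y ｝)
    BrS-xy = lift (λ { (inj₁ refl) → here refl ; (inj₂ refl) → there (here refl) })
           , λ { C (here refl)         → lift ((λ { (_ , here refl) → refl }) , (λ { refl → inj₁ refl , here refl }))
               ; C (there (here refl)) → lift ((λ { (_ , here refl) → refl }) , (λ { refl → inj₂ refl , here refl })) }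
    BrS⇒≐xy : ∀ {X} → BrS L X → X ≐ (｛ x ｝ ∪ ｛ y ｝)
    BrS⇒≐xy (lift X⊆ , f) with f _ (here refl) | f _ (there (here refl))
    ... | lift (_ , x∈) | lift (_ , y∈) =
      (λ m → inL (X⊆ m)) , λ { (inj₁ refl) → proj₁ (x∈ refl) ; (inj₂ refl) → proj₁ (y∈ refl) }
      where
      inL : ∀ {z} → z ∈ x ∷ y ∷ [] → (｛ x ｝ ∪ ｛ y ｝) z
      inL (here refl)         = inj₁ refl
      inL (there (here refl)) = inj₂ refl

  -- id for a disjunction/conjunction pair is the graph of its η-expansion, so it is
  -- total by the weakening, ∨ and ∧ cases.
  Total⁺-idG-∨∧ : ∀ {G₁ G₂} A₁ A₂ C₁ C₂ → Distinct ((A₁ ∨ A₂) ∷ (C₁ ∧ C₂) ∷ []) →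
                  (Distinct (A₁ ∷ C₁ ∷ []) → Total⁺ G₁ (A₁ ∷ C₁ ∷ [])) →
                  (Distinct (A₂ ∷ C₂ ∷ []) → Total⁺ G₂ (A₂ ∷ C₂ ∷ [])) →
                  Total⁺ (wk [ A₂ ] G₁ ⊔ wk [ A₁ ] G₂) ((A₁ ∨ A₂) ∷ (C₁ ∧ C₂) ∷ [])
  Total⁺-idG-∨∧ A₁ A₂ C₁ C₂ u T₁ T₂ =
    Total⁺-↭ (↭-swap₂ (C₁ ∧ C₂) (A₁ ∨ A₂)) (Total⁺-∧ C₁ C₂ [ A₁ ∨ A₂ ] u∧ (side C₁ π₁ u₁ (T₁ (Distinct-∨⁻ˡ A₁ A₂ [ C₁ ] u₁)))
                                                      (side C₂ π₂ u₂ (T₂ (Distinct-∨⁻ʳ A₁ A₂ [ C₂ ] u₂))))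
    where
    u∧ = Distinct-↭ (↭-swap₂ (A₁ ∨ A₂) (C₁ ∧ C₂)) u
    u₁ = Distinct-↭ (↭-swap₂ C₁ (A₁ ∨ A₂)) (Distinct-∧⁻ˡ C₁ C₂ [ A₁ ∨ A₂ ] u∧)
    u₂ = Distinct-↭ (↭-swap₂ C₂ (A₁ ∨ A₂)) (Distinct-∧⁻ʳ C₁ C₂ [ A₁ ∨ A₂ ] u∧)
    π₁ : A₁ ∷ C₁ ∷ A₂ ∷ [] ↭ A₁ ∷ A₂ ∷ C₁ ∷ []
    π₁ = ↭-prep A₁ (↭-swap C₁ A₂ ↭-refl)
    π₂ : A₂ ∷ C₂ ∷ A₁ ∷ [] ↭ A₁ ∷ A₂ ∷ C₂ ∷ []
    π₂ = ↭-trans (↭-prep A₂ (↭-swap C₂ A₁ ↭-refl)) (↭-swap A₂ A₁ ↭-refl)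
    side : ∀ {G} C {A B} → A ∷ C ∷ B ∷ [] ↭ A₁ ∷ A₂ ∷ C ∷ [] → Distinct ((A₁ ∨ A₂) ∷ C ∷ []) →
           Total⁺ G (A ∷ C ∷ []) → Total⁺ (wk [ B ] G) (C ∷ (A₁ ∨ A₂) ∷ [])
    side C {A} {B} π v T =
      Total⁺-↭ (↭-swap₂ (A₁ ∨ A₂) C) (Total⁺-∨ A₁ A₂ [ C ] v
        (Total⁺-↭ π (Total⁺-wk (A ∷ C ∷ []) [ B ] (Distinct-↭ (↭-sym π) (Distinct-∨⁻ A₁ A₂ [ C ] v)) T)))

  Total⁺-idG : ∀ A C → C ≡ₑ neg A → Distinct (A ∷ C ∷ []) → Total⁺ (idG A C) (A ∷ C ∷ [])
  Total⁺-idG (at a x) (at b y) refl _ = Total⁺-idG-at a x y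
  Total⁺-idG (A₁ ∨ A₂) (C₁ ∧ C₂) eq u =
    let eq₁ , eq₂ = ∧-injective eq
    in Total⁺-idG-∨∧ A₁ A₂ C₁ C₂ u (Total⁺-idG A₁ C₁ eq₁) (Total⁺-idG A₂ C₂ eq₂)
  Total⁺-idG (A₁ ∧ A₂) (C₁ ∨ C₂) eq u =
    let eq₁ , eq₂ = ∨-injective eq
    in Total⁺-↭ (↭-swap₂ (C₁ ∨ C₂) (A₁ ∧ A₂))
         (Total⁺-idG-∨∧ C₁ C₂ A₁ A₂ (Distinct-↭ (↭-swap₂ (A₁ ∧ A₂) (C₁ ∨ C₂)) u)
           (Total⁺-idG C₁ A₁ (dual eq₁)) (Total⁺-idG C₂ A₂ (dual eq₂)))
    where
    dual : ∀ {A C} → C ≡ₑ neg A → A ≡ₑ neg C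
    dual {A} eq = trans (cong erase (sym (neg-involutive A))) (sym (≡ₑ-neg eq))

  -- Paths through a cut formula

  -- The path lemma behind the branch condition for cuts, stated for an arbitrary symmetric
  -- sided relation R so that it can be proved by induction on A.
  BranchEdge : SidedRel → Side → Names → Names → Set₁
  BranchEdge R s X B = ∃₂ λ u v → R s u v × (X ∪ B) u × (X ∪ B) v

  CutPaths : Formula → Set₂
  CutPaths A = ∀ (R : SidedRel) (X : Names) →
    Unique (names A) →
    (∀ {z} → X z → z ∉ names A) →
    (∀ {s x y} → R s x y → R s y x) →
    (∀ {s u ms} → u ∈ names A → AltPath R (namesP A) s s u u ms → ⊥) →
    (∀ B → BrF A B → BranchEdge R left X B) →
    (∀ B → BrF (neg A) B → BranchEdge R right X B) →
    AltPathBetween R (namesP A) X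

  CutPaths-at : ∀ a x → CutPaths (at a x)
  CutPaths-at a x R X _ _ R-sym no-loop hG hH =
    combine (near-x (hG ｛ x ｝ (lift ≐-refl))) (near-x (hH ｛ x ｝ (lift ≐-refl)))
    where
    EdgeInX EdgeToX : Side → Set₁
    EdgeInX s = ∃₂ λ u v → R s u v × X u × X v
    EdgeToX s = ∃ λ w → X w × R s w x
    near-x : ∀ {s} → BranchEdge R s X ｛ x ｝ → EdgeInX s ⊎ EdgeToX s
    near-x (u , v , e , inj₁ p    , inj₁ q)    = inj₁ (u , v , e , p , q)
    near-x (u , v , e , inj₁ p    , inj₂ refl) = inj₂ (u , p , e)
    near-x (u , v , e , inj₂ refl , inj₁ q)    = inj₂ (v , q , R-sym e)
    near-x (u , v , e , inj₂ refl , inj₂ refl) = ⊥-elim (no-loop (here refl) (last e))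
    combine : EdgeInX left ⊎ EdgeToX left → EdgeInX right ⊎ EdgeToX right →
              AltPathBetween R (namesP (at a x)) X
    combine (inj₁ (u , v , e , p , q)) _ = u , v , p , q , left , left , [] , last e
    combine (inj₂ _) (inj₁ (u , v , e , p , q)) = u , v , p , q , right , right , [] , last e
    combine (inj₂ (w , pw , ew)) (inj₂ (w′ , pw′ , ew′)) =
      w , w′ , pw , pw′ , left , right , [ x ] , step ew (here refl) (last (R-sym ew′))

  -- For A₁ ∧ A₂, the paths through A₁ provided by the first hypothesis serve as the
  -- right edges ("virtual edges") in the second hypothesis, and are then spliced back in.
  module ∧-Step (A₁ A₂ : Formula) (ih₁ : CutPaths A₁) (ih₂ : CutPaths A₂)
                (R : SidedRel) (X : Names) (uA : Unique (names (A₁ ∧ A₂)))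
                (X∉A : ∀ {z} → X z → z ∉ names (A₁ ∧ A₂))
                (R-sym : ∀ {s x y} → R s x y → R s y x)
                (no-loop : ∀ {s u ms} → u ∈ names (A₁ ∧ A₂) → AltPath R (namesP (A₁ ∧ A₂)) s s u u ms → ⊥)
                (hG : ∀ B → BrF (A₁ ∧ A₂) B → BranchEdge R left X B)
                (hH : ∀ B → BrF (neg (A₁ ∧ A₂)) B → BranchEdge R right X B) where

    S₁ S₂ S : ℕ → Set
    S₁ = namesP A₁
    S₂ = namesP A₂
    S  = namesP (A₁ ∧ A₂)

    S₁∩S₂=∅ : ∀ {z} → S₁ z → S₂ z → ⊥
    S₁∩S₂=∅ = Unique-++⇒disjoint (names A₁) uA

    S₁⊆S : ∀ {z} → S₁ z → S z
    S₁⊆S = ∈-++⁺ˡ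

    S₂⊆S : ∀ {z} → S₂ z → S z
    S₂⊆S = ∈-++⁺ʳ (names A₁)

    R₁ : SidedRel
    R₁ left  u v = R left u v × ¬ S₂ u × ¬ S₂ v
    R₁ right u v = R right u v

    R₁⇒R : ∀ {s u v} → R₁ s u v → R s u v
    R₁⇒R {left}  (e , _ , _) = e
    R₁⇒R {right} e           = e

    R₁-sym : ∀ {s u v} → R₁ s u v → R₁ s v u
    R₁-sym {left}  (e , ¬u , ¬v) = R-sym e , ¬v , ¬u
    R₁-sym {right} e             = R-sym e

    lift₁ : ∀ {s t x y ms} → AltPath R₁ S₁ s t x y ms → AltPath R S s t x y ms
    lift₁ = AltPath-map (λ {s} → R₁⇒R {s}) S₁⊆S

    start-left-avoids-S₂ : ∀ {t x y ms} → AltPath R₁ S₁ left t x y ms → ¬ S₂ x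
    start-left-avoids-S₂ (last (_ , ¬x , _))     = ¬x
    start-left-avoids-S₂ (step (_ , ¬x , _) _ _) = ¬x

    end-left-avoids-S₂ : ∀ {s x y ms} → AltPath R₁ S₁ s left x y ms → ¬ S₂ y
    end-left-avoids-S₂ {left} (last (_ , _ , ¬y)) = ¬y
    end-left-avoids-S₂ (step _ _ p)                = end-left-avoids-S₂ p

    -- Splicing in virtual edges keeps the side of an end step that is a left step or
    -- ends at a vertex of A₂.
    SideKept : Side → ℕ → Side → Set
    SideKept s x s′ = (s ≡ left ⊎ S₂ x) → s′ ≡ s

    Virtual : ℕ → ℕ → Set₁
    Virtual u v = ∃ λ s → ∃ λ t → ∃ λ ms → AltPath R₁ S₁ s t u v ms × (S₂ u → s ≡ right) × (S₂ v → t ≡ right)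

    R₂ : SidedRel
    R₂ left  = R left
    R₂ right = Virtual

    R₂-sym : ∀ {s u v} → R₂ s u v → R₂ s v u
    R₂-sym {left}  e                        = R-sym e
    R₂-sym {right} (s , t , ms , p , a , b) = t , s , reverse ms , AltPath-reverse (λ {s} → R₁-sym {s}) p , b , a

    expand : ∀ {s t x y ms} → AltPath R₂ S₂ s t x y ms →
             ∃ λ s′ → ∃ λ t′ → ∃ λ ms′ → AltPath R S s′ t′ x y ms′ × SideKept s x s′ × SideKept t y t′
    expand {left} (last e) = left , left , [] , last e , (λ _ → refl) , (λ _ → refl)
    expand {right} (last (s₁ , t₁ , _ , p , sx , ty)) =
      s₁ , t₁ , _ , lift₁ p , (λ { (inj₁ ()) ; (inj₂ z) → sx z }) , (λ { (inj₁ ()) ; (inj₂ z) → ty z })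
    expand {left} (step e i rest) with expand rest
    ... | _ , t″ , _ , p″ , rm , ty with rm (inj₂ i)
    ...   | refl = left , t″ , _ , step e (S₂⊆S i) p″ , (λ _ → refl) , ty
    expand {right} (step (s₁ , _ , _ , p , sx , tm) i rest) with expand rest | tm i
    ... | _ , t″ , _ , p″ , lm , ty | refl with lm (inj₁ refl)
    ...   | refl = s₁ , t″ , _ , AltPath-++ (lift₁ p) (S₂⊆S i) p″ , (λ { (inj₁ ()) ; (inj₂ z) → sx z }) , ty

    no-loop₂ : ∀ {s u ms} → u ∈ names A₂ → AltPath R₂ S₂ s s u u ms → ⊥
    no-loop₂ u∈A₂ p with expand p
    ... | _ , _ , _ , p′ , su , tu with su (inj₂ u∈A₂) | tu (inj₂ u∈A₂)
    ...   | refl | refl = no-loop (S₂⊆S u∈A₂) p′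

    virtual-path : ∀ Z → BrF (neg A₂) Z → AltPathBetween R₁ S₁ (X ∪ Z)
    virtual-path Z bZ = ih₁ R₁ (X ∪ Z) (Unique-++⁻ˡ (names A₁) uA) X∪Z∉A₁ (λ {s} → R₁-sym {s}) no-loop₁ hG₁ hH₁
      where
      Z⊆S₂ : ∀ {z} → Z z → S₂ z
      Z⊆S₂ m = ∈names-neg⇒∈names A₂ (BrF⇒⊆names (neg A₂) bZ m)
      X∪Z∉A₁ : ∀ {z} → (X ∪ Z) z → z ∉ names A₁
      X∪Z∉A₁ (inj₁ p) q = X∉A p (S₁⊆S q)
      X∪Z∉A₁ (inj₂ p) q = S₁∩S₂=∅ q (Z⊆S₂ p)
      no-loop₁ : ∀ {s u ms} → u ∈ names A₁ → AltPath R₁ S₁ s s u u ms → ⊥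
      no-loop₁ m p = no-loop (S₁⊆S m) (lift₁ p)
      ∉S₂ : ∀ {B z} → BrF A₁ B → (X ∪ B) z → ¬ S₂ z
      ∉S₂ bB (inj₁ p) q = X∉A p (S₂⊆S q)
      ∉S₂ bB (inj₂ p) q = S₁∩S₂=∅ (BrF⇒⊆names A₁ bB p) q
      hG₁ : ∀ B → BrF A₁ B → BranchEdge R₁ left (X ∪ Z) B
      hG₁ B bB = let u , v , e , pu , pv = hG B (inj₁ bB) in u , v , (e , ∉S₂ bB pu , ∉S₂ bB pv) , widen pu , widen pv
        where
        widen : ∀ {z} → (X ∪ B) z → ((X ∪ Z) ∪ B) z
        widen (inj₁ p) = inj₁ (inj₁ p)
        widen (inj₂ p) = inj₂ p
      hH₁ : ∀ Y → BrF (neg A₁) Y → BranchEdge R₁ right (X ∪ Z) Y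
      hH₁ Y bY = let u , v , e , pu , pv = hH (Y ∪ Z) (Y , Z , bY , bZ , lift ≐-refl) in u , v , e , reassoc pu , reassoc pv
        where
        reassoc : ∀ {z} → (X ∪ (Y ∪ Z)) z → ((X ∪ Z) ∪ Y) z
        reassoc (inj₁ p)        = inj₁ (inj₁ p)
        reassoc (inj₂ (inj₁ p)) = inj₂ p
        reassoc (inj₂ (inj₂ p)) = inj₁ (inj₂ p)

    AltPath⇒Virtual : ∀ {s t x y ms} → AltPath R₁ S₁ s t x y ms → Virtual x y
    AltPath⇒Virtual {s} {t} p = s , t , _ , p , start-right s p , end-right t p
      where
      start-right : ∀ s {t x y ms} → AltPath R₁ S₁ s t x y ms → S₂ x → s ≡ right
      start-right left  p z = ⊥-elim (start-left-avoids-S₂ p z)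
      start-right right p z = refl
      end-right : ∀ t {s x y ms} → AltPath R₁ S₁ s t x y ms → S₂ y → t ≡ right
      end-right left  p z = ⊥-elim (end-left-avoids-S₂ p z)
      end-right right p z = refl

    virtual-edge : ∀ Z → BrF (neg A₂) Z → BranchEdge R₂ right X Z
    virtual-edge Z bZ = let x , y , px , py , _ , _ , _ , p = virtual-path Z bZ in x , y , AltPath⇒Virtual p , px , py

    path : AltPathBetween R S X
    path with ih₂ R₂ X (Unique-++⁻ʳ (names A₁) uA) (λ p q → X∉A p (S₂⊆S q)) (λ {s} → R₂-sym {s}) no-loop₂
                 (λ B bB → hG B (inj₂ bB)) virtual-edge
    ... | x , y , px , py , _ , _ , _ , p = let _ , _ , _ , p′ , _ = expand p in x , y , px , py , _ , _ , _ , p′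

  CutPaths-∧ : ∀ A₁ A₂ → CutPaths A₁ → CutPaths A₂ → CutPaths (A₁ ∧ A₂)
  CutPaths-∧ A₁ A₂ ih₁ ih₂ R X u X∉A R-sym no-loop hG hH = ∧-Step.path A₁ A₂ ih₁ ih₂ R X u X∉A R-sym no-loop hG hH

  CutPaths-neg : ∀ A → CutPaths A → CutPaths (neg A)
  CutPaths-neg A ih R X u X∉A R-sym no-loop hG hH =
    let x , y , px , py , s , t , ms , p =
          ih (λ s → R (other s)) X (subst Unique (names-neg A) u) (λ p q → X∉A p (∈names⇒∈names-neg A q)) R-sym
             (λ m p → no-loop (∈names⇒∈names-neg A m) (swap-sides p))
             (λ B bB → hH B (subst (λ C → BrF C B) (sym (neg-involutive A)) bB))
             hG
    in x , y , px , py , other s , other t , ms , swap-sides p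
    where
    swap-sides : ∀ {s t x y ms} → AltPath (λ s → R (other s)) (namesP A) s t x y ms →
                 AltPath R (namesP (neg A)) (other s) (other t) x y ms
    swap-sides p = AltPath-swap (AltPath-map (λ e → e) (∈names⇒∈names-neg A) p)

  -- A disjunction is the negation of a conjunction of negations.
  cutPaths : ∀ A → CutPaths A
  cutPaths (at a x)  = CutPaths-at a x
  cutPaths (A₁ ∧ A₂) = CutPaths-∧ A₁ A₂ (cutPaths A₁) (cutPaths A₂)
  cutPaths (A₁ ∨ A₂) = subst CutPaths (neg-involutive (A₁ ∨ A₂))
    (CutPaths-neg (neg A₁ ∧ neg A₂) (CutPaths-∧ (neg A₁) (neg A₂) (CutPaths-neg A₁ (cutPaths A₁)) (CutPaths-neg A₂ (cutPaths A₂))))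

  -- Cut

  module Cut (Γ : List Formula) (A : Formula) {G H : BLGraph}
             (u₁ : Distinct (A ∷ Γ)) (u₂ : Distinct (neg A ∷ Γ)) (T₁ : Total⁺ G (A ∷ Γ)) (T₂ : Total⁺ H (neg A ∷ Γ)) where

    I : ℕ → Set
    I = namesP A

    graph : Side → BLGraph
    graph left  = G
    graph right = H

    cutFormula : Side → Formula
    cutFormula left  = A
    cutFormula right = neg A

    premiss : Side → List Formula
    premiss s = cutFormula s ∷ Γ

    total : ∀ s → Total⁺ (graph s) (premiss s)
    total left  = T₁
    total right = T₂

    distinct : ∀ s → Distinct (premiss s)
    distinct left  = u₁
    distinct right = u₂

    cutNames⊆I : ∀ s {z} → z ∈ names (cutFormula s) → I z
    cutNames⊆I left  m = m
    cutNames⊆I right m = ∈names-neg⇒∈names A m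

    Γ∩I=∅ : ∀ {z} → z ∈ nameList Γ → ¬ I z
    Γ∩I=∅ m i = Distinct-++⇒disjoint [ A ] Γ u₁ (∈-++⁺ˡ i) m

    premiss⇒Γ : ∀ s {z} → z ∈ nameList (premiss s) → ¬ I z → z ∈ nameList Γ
    premiss⇒Γ s m ¬i with ∈-++⁻ (names (cutFormula s)) m
    ... | inj₁ p = ⊥-elim (¬i (cutNames⊆I s p))
    ... | inj₂ p = p

    Γ⇒premiss : ∀ s {z} → z ∈ nameList Γ → z ∈ nameList (premiss s)
    Γ⇒premiss s = ∈-++⁺ʳ (names (cutFormula s))

    Step : Names → SidedRel
    Step X s u v = restrictEdge (graph s) I u v X

    Step-sym : ∀ X {s u v} → Step X s u v → Step X s v u
    Step-sym X {s} (Y , e , eq) = Y , edge-sym (total s) e , eq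

    colour : Side → ℕ → Atom → Set
    colour s = AtomAt (premiss s)

    colour-inside : ∀ {s u a} → I u → colour s u a → colour (other s) u (bar a)
    colour-inside {left}  i (_ , here refl , p) = neg A , here refl , ⊑-neg p
    colour-inside {right} i (_ , here refl , p) = A , here refl , subst (λ C → at _ _ ⊑ C) (neg-involutive A) (⊑-neg p)
    colour-inside {s}     i (B , there m , p)   = ⊥-elim (Γ∩I=∅ (∈-nameList⁺ Γ m (at⊑⇒∈names p)) i)

    colour⇒AtomAt : ∀ {s u a} → ¬ I u → colour s u a → AtomAt Γ u a
    colour⇒AtomAt {s} ¬i (_ , here refl , p) = ⊥-elim (¬i (cutNames⊆I s (at⊑⇒∈names p)))
    colour⇒AtomAt     ¬i (B , there m , p)   = B , m , p

    colour-outside : ∀ {s u a} → ¬ I u → colour s u a → colour (other s) u a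
    colour-outside {s} ¬i c = let B , m , p = colour⇒AtomAt {s} ¬i c in B , there m , p

    module Colours (X : Names) = Colouring bar bar-involutive bar-fixpoint-free (Step X) I colour
      (λ {s} (_ , e , _) → edge-dual (total s) e) (λ {s} → AtomAt-functional (distinct s))
      (λ {s} → colour-inside {s}) (λ {s} → colour-outside {s})

    Vboth V⊙ : ℕ → Set
    Vboth = V G ∪ V H
    V⊙    = Vboth ∖ I

    V-graph⊆Vboth : ∀ s {z} → V (graph s) z → Vboth z
    V-graph⊆Vboth left  v = inj₁ v
    V-graph⊆Vboth right v = inj₂ v

    Step-vertices : ∀ X {s u v} → Step X s u v → Vboth u × Vboth v
    Step-vertices X {s} (_ , e , _) =
      let yu , yv = edge-label (total s) e
          lift Y⊆ , _ = BrG⊆BrS (total s) (_ , _ , e)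
      in V-graph⊆Vboth s (names⊆V (total s) (Y⊆ yu)) , V-graph⊆Vboth s (names⊆V (total s) (Y⊆ yv))

    AltPath⇒AltFrom : ∀ {X s t x y ms} → AltPath (Step X) I s t x y ms → AltFrom (graph s) (graph (other s)) I X (x ∷ ms ++ [ y ])
    AltPath⇒AltFrom (last e)                 = e , tt
    AltPath⇒AltFrom {s = left}  (step e _ p) = e , AltPath⇒AltFrom p
    AltPath⇒AltFrom {s = right} (step e _ p) = e , AltPath⇒AltFrom p

    AltFrom⇒AltPath : ∀ {X s x y} ms → AltFrom (graph s) (graph (other s)) I X (x ∷ ms ++ [ y ]) → All I ms →
                      ∃ λ t → AltPath (Step X) I s t x y ms
    AltFrom⇒AltPath {s = s} [] (e , _) [] = s , last e
    AltFrom⇒AltPath {s = left}  (m ∷ ms) (e , r) (i ∷ is) = let t , p = AltFrom⇒AltPath {s = right} ms r is in t , step e i p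
    AltFrom⇒AltPath {s = right} (m ∷ ms) (e , r) (i ∷ is) = let t , p = AltFrom⇒AltPath {s = left}  ms r is in t , step e i p

    edge⊙ : ℕ → ℕ → Names → Set₁
    edge⊙ = edge (G ⊙[ I ] H)

    SimpleAltPath : Names → ℕ → ℕ → Set₁
    SimpleAltPath X x y = ∃ λ s → ∃ λ t → ∃ λ ms → AltPath (Step X) I s t x y ms × Unique (x ∷ ms ++ [ y ])

    edge⊙⇒path : ∀ {x y X} → edge⊙ x y X → SimpleAltPath X x y
    edge⊙⇒path (_ , ms , lift (u , _ , is) , _ , inj₁ a) = let t , p = AltFrom⇒AltPath {s = left}  ms a is in left  , t , ms , p , u
    edge⊙⇒path (_ , ms , lift (u , _ , is) , _ , inj₂ a) = let t , p = AltFrom⇒AltPath {s = right} ms a is in right , t , ms , p , u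

    path⇒edge⊙ : ∀ {X x y} → X ⊆ V⊙ → V⊙ x → V⊙ y → SimpleAltPath X x y → edge⊙ x y X
    path⇒edge⊙ {X} {x} {y} X⊆ vx vy (s , _ , ms , p , u) =
      lift (x≢y , vx , vy , X⊆) , ms , lift (u , AltPath-vertices Vboth (Step-vertices X) p , AltPath-interior p)
        , lift (proj₂ vx , proj₂ vy) , alt s p
      where
      x≢y : x ≢ y
      x≢y refl = Unique[x∷xs]⇒x∉xs u (∈-++⁺ʳ ms (here refl))
      alt : ∀ s {t} → AltPath (Step X) I s t x y ms → AltFrom G H I X (x ∷ ms ++ [ y ]) ⊎ AltFrom H G I X (x ∷ ms ++ [ y ])
      alt left  p = inj₁ (AltPath⇒AltFrom p)
      alt right p = inj₂ (AltPath⇒AltFrom p)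

    edge⊙-sym : ∀ {x y X} → edge⊙ x y X → edge⊙ y x X
    edge⊙-sym {x} {y} {X} e@(lift (_ , vx , vy , X⊆) , _) =
      let s , t , ms , p , u = edge⊙⇒path e
          u′ = subst Unique (reverse-∷-++-[] x ms y) (Unique-resp-↭ (↭-sym (↭-reverse (x ∷ ms ++ [ y ]))) u)
      in path⇒edge⊙ X⊆ vy vx (t , s , reverse ms , AltPath-reverse (Step-sym X) p , u′)

    start∈label : ∀ {X s t x y ms} → AltPath (Step X) I s t x y ms → ¬ I x → X x
    start∈label {s = s} (last (_ , e , lift eq))     ¬i = proj₂ eq (proj₁ (edge-label (total s) e) , ¬i)
    start∈label {s = s} (step (_ , e , lift eq) _ _) ¬i = proj₂ eq (proj₁ (edge-label (total s) e) , ¬i)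

    edge⊙-label : ∀ {x y X} → edge⊙ x y X → X x × X y
    edge⊙-label e@(lift (_ , vx , vy , _) , _) =
      let _ , _ , _ , p , _ = edge⊙⇒path e
          _ , _ , _ , q , _ = edge⊙⇒path (edge⊙-sym e)
      in start∈label p (proj₂ vx) , start∈label q (proj₂ vy)

    edge⊙-dual : DualEdges (G ⊙[ I ] H) Γ
    edge⊙-dual {X = X} e@(lift (_ , vx , vy , _) , _) =
      let s , t , _ , p , _ = edge⊙⇒path e
          c , cx = Colours.start-colour X p
      in c , colour⇒AtomAt {s} (proj₂ vx) cx , colour⇒AtomAt {t} (proj₂ vy) (Colours.end-colour X p cx)

    V⊙⊆names : ∀ {x} → V⊙ x → x ∈ nameList Γ
    V⊙⊆names (inj₁ v , ¬i) = premiss⇒Γ left  (V⊆names T₁ v) ¬i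
    V⊙⊆names (inj₂ v , ¬i) = premiss⇒Γ right (V⊆names T₂ v) ¬i

    names⊆V⊙ : ∀ {x} → x ∈ nameList Γ → V⊙ x
    names⊆V⊙ m = inj₁ (names⊆V T₁ (Γ⇒premiss left m)) , Γ∩I=∅ m

    BrS-drop-cut : ∀ s {Y} → BrS (premiss s) Y → BrS Γ (Y ∖ I)
    BrS-drop-cut left  b = BrS-∷⁻ A Γ u₁ b
    BrS-drop-cut right b = BrS-resp-≐ Γ ((λ (p , q) → p , λ r → q (∈names⇒∈names-neg A r)) ,
                                          (λ (p , q) → p , λ r → q (cutNames⊆I right r))) (BrS-∷⁻ (neg A) Γ u₂ b)

    first-step : ∀ {X s t x y ms} → AltPath (Step X) I s t x y ms → ∃ λ m → Step X s x m
    first-step (last e)     = _ , e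
    first-step (step e _ _) = _ , e

    BrG⊙⊆BrS : ∀ {X} → BrG (G ⊙[ I ] H) X → BrS Γ X
    BrG⊙⊆BrS (x , y , e) =
      let s , _ , _ , p , _ = edge⊙⇒path e
          m , Y , e′ , lift eq = first-step p
      in BrS-resp-≐ Γ (≐-sym eq) (BrS-drop-cut s (BrG⊆BrS (total s) (x , m , e′)))

    -- B ∪ X is a branch of the premiss, and removing the cut names from it leaves X.
    branch-step : ∀ s {X} → BrS Γ X → ∀ B → BrF (cutFormula s) B → BranchEdge (Step X) s X B
    branch-step s {X} b B bB =
      let u , v , e = BrS⊆BrG (total s) (BrS-∷⁺ (cutFormula s) Γ (distinct s) bB b)
          pu , pv = edge-label (total s) e
      in u , v , (_ , e , lift ((λ p → inj₂ p , Γ∩I=∅ (lower (proj₁ b) p)) , onlyX)) , swap∪ pu , swap∪ pv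
      where
      onlyX : ((B ∪ X) ∖ I) ⊆ X
      onlyX (inj₁ q , ¬i) = ⊥-elim (¬i (cutNames⊆I s (BrF⇒⊆names (cutFormula s) bB q)))
      onlyX (inj₂ q , _)  = q
      swap∪ : ∀ {z} → (B ∪ X) z → (X ∪ B) z
      swap∪ (inj₁ p) = inj₂ p
      swap∪ (inj₂ p) = inj₁ p

    BrS⊆BrG⊙ : ∀ {X} → BrS Γ X → BrG (G ⊙[ I ] H) X
    BrS⊆BrG⊙ {X} b@(lift X⊆ , _) =
      let x , y , px , py , _ , _ , _ , p =
            cutPaths A (Step X) X (Unique-++⁻ˡ (names A) u₁) (λ p → Γ∩I=∅ (X⊆ p)) (λ {s} → Step-sym X {s})
                     (λ _ p → Colours.no-loop X p) (branch-step left b) (branch-step right b)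
          _ , ms′ , p′ , u = Colours.simple-path X (Γ∩I=∅ (X⊆ py)) p
      in x , y , path⇒edge⊙ inV⊙ (inV⊙ px) (inV⊙ py) (_ , _ , ms′ , p′ , u)
      where
      inV⊙ : ∀ {z} → X z → V⊙ z
      inV⊙ q = names⊆V⊙ (X⊆ q)

  Total⁺-⊙ : ∀ Γ A {G H} → Distinct (A ∷ Γ) → Distinct (neg A ∷ Γ) → Total⁺ G (A ∷ Γ) → Total⁺ H (neg A ∷ Γ) →
             Total⁺ (G ⊙[ namesP A ] H) Γ
  Total⁺-⊙ Γ A u₁ u₂ T₁ T₂ = record
    { V⊆names    = V⊙⊆names
    ; names⊆V    = names⊆V⊙
    ; BrG⊆BrS    = BrG⊙⊆BrS
    ; BrS⊆BrG    = BrS⊆BrG⊙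
    ; edge-sym   = edge⊙-sym
    ; edge-label = edge⊙-label
    ; edge-dual  = edge⊙-dual }
    where open Cut Γ A u₁ u₂ T₁ T₂

  ⟪⟫-Total⁺ : ∀ {Δ} (P : Deriv Δ) → Total⁺ ⟪ P ⟫ Δ
  ⟪⟫-Total⁺ (ax Γ A B A≡B π sf) =
    let u = Distinct-↭ π (sharingFree⇒distinct sf)
        idG-total = Total⁺-idG A (neg B) (≡ₑ-neg (sym A≡B)) (Distinct-++⁻ˡ (A ∷ neg B ∷ []) Γ u)
    in Total⁺-↭ (↭-sym π) (Total⁺-wk (A ∷ neg B ∷ []) Γ u idG-total)
  ⟪⟫-Total⁺ (cut Γ A Q R π _) =
    Total⁺-↭ (↭-sym π) (Total⁺-⊙ Γ A (conclusion-distinct Q) (conclusion-distinct R) (⟪⟫-Total⁺ Q) (⟪⟫-Total⁺ R))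
  ⟪⟫-Total⁺ (sup Γ Q R π _) = Total⁺-↭ (↭-sym π) (Total⁺-⊔ (⟪⟫-Total⁺ Q) (⟪⟫-Total⁺ R))
  ⟪⟫-Total⁺ (orR Γ A B Q π sf) =
    Total⁺-↭ (↭-sym π) (Total⁺-∨ A B Γ (Distinct-↭ π (sharingFree⇒distinct sf)) (⟪⟫-Total⁺ Q))
  ⟪⟫-Total⁺ (andR Γ A B Q R π sf) =
    Total⁺-↭ (↭-sym π) (Total⁺-∧ A B Γ (Distinct-↭ π (sharingFree⇒distinct sf)) (⟪⟫-Total⁺ Q) (⟪⟫-Total⁺ R))

  Total⁺⇒Total : ∀ {G Γ} → Distinct Γ → Total⁺ G Γ → Total G Γ
  Total⁺⇒Total {G} {Γ} u T =
    (λ _ → mk⇔ (V⊆names T) (names⊆V T)) , (λ _ → mk⇔ (BrG⊆BrS T) (BrS⊆BrG T)) , dual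
    where
    dual : ∀ x y X → edge G x y X → ∀ α β → AtomAt Γ x α → AtomAt Γ y β → α ≡ bar β
    dual x y X e α β xα yβ =
      let a , xa , ya = edge-dual T e
      in trans (AtomAt-functional u xα xa) (trans (sym (bar-involutive a)) (cong bar (AtomAt-functional u ya yβ)))

corollary5 : (Atom : Set) (bar : Atom → Atom)
    → (∀ a → bar (bar a) ≡ a) → (∀ a → bar a ≢ a)
    → (Γ : List (GS4.Formula Atom bar)) (P : GS4.Deriv Atom bar Γ)
    → GS4.Total Atom bar (GS4.⟪_⟫ Atom bar P) Γ
corollary5 Atom bar bar-involutive bar-fixpoint-free Γ P = Total⁺⇒Total (conclusion-distinct P) (⟪⟫-Total⁺ P)
  where
  open Syntax Atom bar
  open Totality Atom bar bar-involutive bar-fixpoint-free
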